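{- Let $b\ge2$, $n\in\mathbb N$, $\sigma$ a permutation of $\{0,\dots,b-1\}$ and $\Sigma\in\{\sigma,\overline\sigma\}^n$. Let $\mathbf j=(j_1,j_2)\in\mathbb N_0^2$ with $j_1+j_2<n-1$, $m_i\in\{0,\dots,b^{j_i}-1\}$ and $\ell_i\in\{1,\dots,b-1\}$ for $i=1,2$. For each $\mathbf z=(z_1,z_2)\in\mathcal R^\Sigma_{b,n}\cap I_{\mathbf j,\mathbf m}$ let $(k_1,k_2)\in\{0,\dots,b-1\}^2$ be such that $\mathbf z\in I_{j_1,m_1}^{k_1}\times I_{j_2,m_2}^{k_2}$. Then $$\sum_{\mathbf z\in\mathcal R^\Sigma_{b,n}\cap I_{\mathbf j,\mathbf m}}\prod_{i=1}^2\left((bm_i+k_i-b^{j_i+1}z_i)\mathrm e^{\frac{2\pi i}{b}k_i\ell_i}-\sum_{r_i=0}^{k_i-1}\mathrm e^{\frac{2\pi i}{b}r_i\ell_i}\right)$$ $$=\frac{b^{n-j_1-j_2}}{(\mathrm e^{\frac{2\pi i}b\ell_1}-1)(\mathrm e^{\frac{2\pi i}b\ell_2}-1)}+s\,b^{j_1+j_2-n}\sum_{k_1=0}^{b-1}\sigma^{ -1}(k_1)\mathrm e^{\frac{2\pi i}{b}p(k_1)\ell_1}\sum_{k_2=0}^{b-1}\sigma(k_2)\mathrm e^{\frac{2\pi i}{b}k_2\ell_2},$$ where either $p(k)=k$ for all $k$ or $p(k)=-k-1$ for all $k$, with the choice depending only on $j_1$ (for fixed $n,\Sigma$), and $s\in\{1,-1\}$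 depends only on $j_2$ (for fixed $n,\Sigma$).
   Context: $\tau(k)=b-1-k$, $\overline\sigma=\tau\circ\sigma$; for $\Sigma=(\sigma_1,\dots,\sigma_n)$, $\mathcal{R}_{b,n}^{\Sigma}=\left\{\left(\frac{\sigma_n(a_n)}{b}+\dots+\frac{\sigma_1(a_1)}{b^n},\ \frac{a_1}{b}+\dots+\frac{a_n}{b^n}\right): a_i\in\{0,\dots,b-1\}\right\}$. For $j\in\mathbb N_0$, $m\in\{0,\dots,b^j-1\}$: $I_{j,m}=[m/b^j,(m+1)/b^j)$, $I^k_{j,m}=[m/b^j+k/b^{j+1},m/b^j+(k+1)/b^{j+1})$; $I_{\mathbf j,\mathbf m}=I_{j_1,m_1}\times I_{j_2,m_2}$. -}

module Defs where

open import Data.Nat as ℕ using (ℕ; zero; suc; _≤_; _<_; _≤?_; _<?_)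
open import Data.Fin using (Fin; toℕ; opposite)
open import Data.Fin.Permutation using (Permutation; _⟨$⟩ʳ_; _⟨$⟩ˡ_)
open import Data.Bool using (Bool; true; false; if_then_else_)
open import Data.Sign using (Sign)
open import Data.Product using (_×_)
open import Data.Vec.Functional using (_∷_)
open import Relation.Nullary using (Dec; does)
open import Relation.Nullary.Decidable using (_×-dec_)
open import Relation.Nullary.Negation using (¬_)
open import Algebra.Bundles using (CommutativeRing)
import Level
import Data.Fin

sumℕ : (n : ℕ) → (Fin n → ℕ) → ℕ
sumℕ zero    f = 0
sumℕ (suc n) f = f Data.Fin.zero ℕ.+ sumℕ n (λ i → f (Data.Fin.suc i))

τ : {b : ℕ} → Fin b → Fin b
τ = opposite

σbar : {b : ℕ} → Permutation b b → Fin b → Fin b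
σbar σ k = τ (σ ⟨$⟩ʳ k)

-- Σ ∈ {σ, σ̄}^n is encoded by a Bool vector: true ↦ σ, false ↦ σ̄
choose : {b : ℕ} → Permutation b b → Bool → Fin b → Fin b
choose σ true  k = σ ⟨$⟩ʳ k
choose σ false k = σbar σ k

-- A point is indexed by its digit vector
-- a = (a_1,…,a_n) (0-based: a t = a_{t+1}), and both coordinates are
-- written as N / b^n with N a natural number:
--   z₁ = σ_n(a_n)/b + … + σ_1(a_1)/b^n = N₁ / b^n,  N₁ = Σ_i σ_i(a_i) b^{i-1}
--   z₂ = a_1/b + … + a_n/b^n          = N₂ / b^n,  N₂ = Σ_i a_i b^{n-i}

numer₁ : (b n : ℕ) → Permutation b b → (Fin n → Bool) → (Fin n → Fin b) → ℕ
numer₁ b n σ Σ a = sumℕ n (λ t → toℕ (choose σ (Σ t) (a t)) ℕ.* b ℕ.^ toℕ t)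

numer₂ : (b n : ℕ) → (Fin n → Fin b) → ℕ
numer₂ b n a = sumℕ n (λ t → toℕ (a t) ℕ.* b ℕ.^ (n ℕ.∸ suc (toℕ t)))

-- Membership of z = N / b^n in the b-adic intervals (denominators cleared,
-- valid for j + 1 ≤ n):
--   z ∈ I_{j,m}    ⟺ m b^{n-j} ≤ N < (m+1) b^{n-j}
--   z ∈ I^k_{j,m}  ⟺ (bm+k) b^{n-j-1} ≤ N < (bm+k+1) b^{n-j-1}

InI : (b n j m N : ℕ) → Set
InI b n j m N = m ℕ.* b ℕ.^ (n ℕ.∸ j) ≤ N × N < suc m ℕ.* b ℕ.^ (n ℕ.∸ j)

InI? : (b n j m N : ℕ) → Dec (InI b n j m N)
InI? b n j m N = (_ ≤? N) ×-dec (N <? _)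

InIk : (b n j m k N : ℕ) → Set
InIk b n j m k N =
  (b ℕ.* m ℕ.+ k) ℕ.* b ℕ.^ (n ℕ.∸ suc j) ≤ N × N < suc (b ℕ.* m ℕ.+ k) ℕ.* b ℕ.^ (n ℕ.∸ suc j)

InIk? : (b n j m k N : ℕ) → Dec (InIk b n j m k N)
InIk? b n j m k N = (_ ≤? N) ×-dec (N <? _)

-- The field is a commutative ring R together
-- with an inverse function `inv` (satisfying x ≉ 0 → x · inv x ≈ 1, a
-- hypothesis of the theorem).  ω plays the role of e^{2πi/b}.

module FieldDefs {c ℓ} (R : CommutativeRing c ℓ) where
  open CommutativeRing R

  fromℕ : ℕ → Carrier
  fromℕ zero    = 0#
  fromℕ (suc n) = 1# + fromℕ n

  infixr 8 _^ᴿ_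
  _^ᴿ_ : Carrier → ℕ → Carrier
  x ^ᴿ zero  = 1#
  x ^ᴿ suc n = x * x ^ᴿ n

  ∑ : (n : ℕ) → (Fin n → Carrier) → Carrier
  ∑ zero    f = 0#
  ∑ (suc n) f = f Data.Fin.zero + ∑ n (λ i → f (Data.Fin.suc i))

  ∑digits : (b n : ℕ) → ((Fin n → Fin b) → Carrier) → Carrier
  ∑digits b zero    f = f (λ ())
  ∑digits b (suc n) f = ∑ b (λ d → ∑digits b n (λ a → f (d ∷ a)))

  [_]·_ : {P : Set} → Dec P → Carrier → Carrier
  [ d ]· x = if does d then x else 0#

  signᴿ : Sign → Carrier
  signᴿ Sign.+ = 1#
  signᴿ Sign.- = - 1#

  IsInverse : (Carrier → Carrier) → Set (c Level.⊔ ℓ)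
  IsInverse inv = ∀ x → ¬ (x ≈ 0#) → x * inv x ≈ 1#

  CharZero : Set ℓ
  CharZero = ∀ n → ¬ (fromℕ (suc n) ≈ 0#)

  PrimitiveRoot : ℕ → Carrier → Set ℓ
  PrimitiveRoot b ω = ω ^ᴿ b ≈ 1# × (∀ k → 0 < k → k < b → ¬ (ω ^ᴿ k ≈ 1#))

  -- factor  (b m + k − b^{j+1} z) e^{2πi k ℓ/b} − Σ_{r<k} e^{2πi r ℓ/b},
  -- where z = N / b^n, so b^{j+1} z = N / b^{n-j-1}
  factor : (inv : Carrier → Carrier) (ω : Carrier) (b n j m k ℓ' N : ℕ) → Carrier
  factor inv ω b n j m k ℓ' N =
    (fromℕ (b ℕ.* m ℕ.+ k) - fromℕ N * inv (fromℕ (b ℕ.^ (n ℕ.∸ suc j)))) * ω ^ᴿ (k ℕ.* ℓ')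
    - ∑ k (λ r → ω ^ᴿ (toℕ r ℕ.* ℓ'))

  -- left-hand side: the sum over z ∈ R^Σ_{b,n} ∩ I_{j,m}; the digits
  -- (k₁,k₂) with z ∈ I^{k₁}_{j₁,m₁} × I^{k₂}_{j₂,m₂} are selected by indicators
  LHS : (inv : Carrier → Carrier) (ω : Carrier) (b n : ℕ) (σ : Permutation b b)
        (Σ : Fin n → Bool) (j₁ j₂ m₁ m₂ ℓ₁ ℓ₂ : ℕ) → Carrier
  LHS inv ω b n σ Σ j₁ j₂ m₁ m₂ ℓ₁ ℓ₂ =
    ∑digits b n λ a →
      let N₁ = numer₁ b n σ Σ a
          N₂ = numer₂ b n a
      in [ InI? b n j₁ m₁ N₁ ×-dec InI? b n j₂ m₂ N₂ ]·
           ∑ b (λ k₁ → ∑ b (λ k₂ →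
             [ InIk? b n j₁ m₁ (toℕ k₁) N₁ ×-dec InIk? b n j₂ m₂ (toℕ k₂) N₂ ]·
               (factor inv ω b n j₁ m₁ (toℕ k₁) ℓ₁ N₁
                 * factor inv ω b n j₂ m₂ (toℕ k₂) ℓ₂ N₂)))

  -- e^{2πi p(k) ℓ / b}, with p(k) = k (flag true) or p(k) = -k-1 (flag false)
  expP : (inv : Carrier → Carrier) (ω : Carrier) → Bool → ℕ → ℕ → Carrier
  expP inv ω true  k ℓ' = ω ^ᴿ (k ℕ.* ℓ')
  expP inv ω false k ℓ' = inv (ω ^ᴿ (suc k ℕ.* ℓ'))

  RHS : (inv : Carrier → Carrier) (ω : Carrier) (b n : ℕ) (σ : Permutation b b)
        (p : Bool) (s : Sign) (j₁ j₂ ℓ₁ ℓ₂ : ℕ) → Carrier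
  RHS inv ω b n σ p s j₁ j₂ ℓ₁ ℓ₂ =
    fromℕ (b ℕ.^ (n ℕ.∸ (j₁ ℕ.+ j₂)))
      * inv ((ω ^ᴿ ℓ₁ - 1#) * (ω ^ᴿ ℓ₂ - 1#))
    + signᴿ s * inv (fromℕ (b ℕ.^ (n ℕ.∸ (j₁ ℕ.+ j₂))))
      * ∑ b (λ k₁ → fromℕ (toℕ (σ ⟨$⟩ˡ k₁)) * expP inv ω p (toℕ k₁) ℓ₁)
      * ∑ b (λ k₂ → fromℕ (toℕ (σ ⟨$⟩ʳ k₂)) * ω ^ᴿ (toℕ k₂ ℕ.* ℓ₂))

-- Split n = j₂ + 1 + F + 1 + j₁ and a digit vector as (P, d₂, f, d₁, S). The coordinate z₂ reads the
-- digits in this order and z₁ reads their Σ-images backwards, so z ∈ I_{j,m} says exactly that P and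
-- the chosen digits of S encode m₂ and m₁ (one choice each), and then (k₁, k₂) are the chosen d₁ and d₂.
-- On that cell each factor equals −(r/D)·ω^{kℓ} − Σ_{r<k} ω^{rℓ}, with r affine in the remaining digits.
-- Expanding the product, every term that still contains a complete sum Σ_d ω^{dℓ} = 0 vanishes; what
-- survives are Σ_k Σ_{r<k} ω^{rℓ} = −b/(ω^ℓ − 1), giving the first term, and the twisted sums
-- Σ_d d·ω^{σ(d)ℓ₁} and Σ_d σ(d)·ω^{dℓ₂}. Using σ̄ instead of σ at d₁ turns ω^{kℓ₁} into ω^{−(k+1)ℓ₁},
-- which is p, and at d₂ it flips the sign, which is s.

module Submission where

open import Defs
open import Data.Nat as ℕ using (ℕ; zero; suc; _≤_; _<_; _≟_; s≤s; z≤n)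
import Data.Nat.Properties as ℕ
open import Data.Nat.DivMod using (_/_; _%_; m≡m%n+[m/n]*n; m%n<n; m<n*o⇒m/o<n)
open import Data.Nat.Solver using (module +-*-Solver)
open import Data.Integer.Base as ℤ using (ℤ; -[1+_])
import Data.Integer.Properties as ℤ
open import Data.Fin as Fin using (Fin; toℕ; _↑ˡ_; _↑ʳ_)
import Data.Fin.Properties as Fin
open import Data.Fin.Permutation as Perm using (Permutation; _⟨$⟩ʳ_; _⟨$⟩ˡ_; _∘ₚ_)
open import Data.Bool using (Bool; true; false)
open import Data.Sign as Sign using (Sign)
open import Data.Vec.Functional using (_∷_)
open import Data.Product using (Σ-syntax; _×_; _,_; proj₁; proj₂)
open import Data.Empty using (⊥-elim)
open import Data.Maybe using (Maybe; just; nothing)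
open import Relation.Nullary using (Dec; yes; no; ¬_)
open import Relation.Nullary.Decidable using (_×-dec_)
open import Relation.Binary.Definitions using (tri<; tri≈; tri>)
open import Relation.Binary.PropositionalEquality as ≡ using (_≡_)
open import Algebra.Bundles using (CommutativeRing)
import Algebra.Solver.Ring
open import Algebra.Solver.Ring.AlmostCommutativeRing using (fromCommutativeRing; _-Raw-AlmostCommutative⟶_)
import Algebra.Solver.CommutativeMonoid as CommutativeMonoidSolver
import Algebra.Properties.Semiring.Mult as SemiringMult
import Algebra.Properties.Semiring.Mult.TCOptimised as SemiringMultTC
import Algebra.Properties.Semiring.Sum as SemiringSum
import Algebra.Properties.Semiring.Exp as SemiringExp
import Algebra.Properties.Ring as RingProperties
import Algebra.Properties.AbelianGroup as AbelianGroupProperties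
import Algebra.Properties.CommutativeSemigroup as CommutativeSemigroupProperties
import Algebra.Properties.Group as GroupProperties

module DigitExpansion where
  open import Data.Nat.Base using (_+_; _*_; _^_; _∸_)
  open import Data.Nat.Properties
  open ≡
  open +-*-Solver

  append : ∀ {A : Set} p {q} → (Fin p → A) → (Fin q → A) → Fin (p + q) → A
  append zero    x y = y
  append (suc p) x y = x Fin.zero ∷ append p (λ i → x (Fin.suc i)) y

  append-↑ˡ : ∀ {A : Set} p {q} (x : Fin p → A) (y : Fin q → A) i → append p x y (i ↑ˡ q) ≡ x i
  append-↑ˡ (suc p) x y Fin.zero    = refl
  append-↑ˡ (suc p) x y (Fin.suc i) = append-↑ˡ p (λ i → x (Fin.suc i)) y i

  append-↑ʳ : ∀ {A : Set} p {q} (x : Fin p → A) (y : Fin q → A) j → append p x y (p ↑ʳ j) ≡ y j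
  append-↑ʳ zero    x y j = refl
  append-↑ʳ (suc p) x y j = append-↑ʳ p (λ i → x (Fin.suc i)) y j

  sumℕ-cong : ∀ n {f g : Fin n → ℕ} → (∀ i → f i ≡ g i) → sumℕ n f ≡ sumℕ n g
  sumℕ-cong zero    f≗g = refl
  sumℕ-cong (suc n) f≗g = cong₂ _+_ (f≗g Fin.zero) (sumℕ-cong n (λ i → f≗g (Fin.suc i)))

  *-distribˡ-sumℕ : ∀ b n (f : Fin n → ℕ) → b * sumℕ n f ≡ sumℕ n (λ i → b * f i)
  *-distribˡ-sumℕ b zero    f = *-zeroʳ b
  *-distribˡ-sumℕ b (suc n) f =
    trans (*-distribˡ-+ b (f Fin.zero) _) (cong (b * f Fin.zero +_) (*-distribˡ-sumℕ b n (λ i → f (Fin.suc i))))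

  littleEndian : (b n : ℕ) → (Fin n → ℕ) → ℕ
  littleEndian b n c = sumℕ n (λ t → c t * b ^ toℕ t)

  bigEndian : (b n : ℕ) → (Fin n → ℕ) → ℕ
  bigEndian b n c = sumℕ n (λ t → c t * b ^ (n ∸ suc (toℕ t)))

  littleEndian-cong : ∀ b n {c d : Fin n → ℕ} → (∀ i → c i ≡ d i) → littleEndian b n c ≡ littleEndian b n d
  littleEndian-cong b n c≗d = sumℕ-cong n (λ i → cong (_* _) (c≗d i))

  bigEndian-cong : ∀ b n {c d : Fin n → ℕ} → (∀ i → c i ≡ d i) → bigEndian b n c ≡ bigEndian b n d
  bigEndian-cong b n c≗d = sumℕ-cong n (λ i → cong (_* _) (c≗d i))

  littleEndian-suc : ∀ b n (c : Fin (suc n) → ℕ) →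
    littleEndian b (suc n) c ≡ c Fin.zero + b * littleEndian b n (λ t → c (Fin.suc t))
  littleEndian-suc b n c = cong₂ _+_ (*-identityʳ (c Fin.zero)) (begin
      sumℕ n (λ t → c (Fin.suc t) * (b * b ^ toℕ t))
    ≡⟨ sumℕ-cong n (λ t → *-assoc-comm (c (Fin.suc t)) b (b ^ toℕ t)) ⟩
      sumℕ n (λ t → b * (c (Fin.suc t) * b ^ toℕ t))
    ≡⟨ *-distribˡ-sumℕ b n _ ⟨
      b * littleEndian b n (λ t → c (Fin.suc t))
    ∎)
    where
    open ≡-Reasoning
    *-assoc-comm : ∀ x y z → x * (y * z) ≡ y * (x * z)
    *-assoc-comm = solve 3 (λ x y z → x :* (y :* z) := y :* (x :* z)) refl

  littleEndian-append : ∀ b p q (c : Fin (p + q) → ℕ) →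
    littleEndian b (p + q) c ≡ littleEndian b p (λ i → c (i ↑ˡ q)) + b ^ p * littleEndian b q (λ j → c (p ↑ʳ j))
  littleEndian-append b zero    q c = sym (+-identityʳ _)
  littleEndian-append b (suc p) q c = begin
      littleEndian b (suc (p + q)) c
    ≡⟨ littleEndian-suc b (p + q) c ⟩
      c Fin.zero + b * littleEndian b (p + q) (λ t → c (Fin.suc t))
    ≡⟨ cong (λ z → c Fin.zero + b * z) (littleEndian-append b p q (λ t → c (Fin.suc t))) ⟩
      c Fin.zero + b * (L + b ^ p * L′)
    ≡⟨ solve 5 (λ x b u v w → x :+ b :* (u :+ v :* w) := (x :+ b :* u) :+ (b :* v) :* w) refl (c Fin.zero) b L (b ^ p) L′ ⟩
      (c Fin.zero + b * L) + b ^ suc p * L′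
    ≡⟨ cong (_+ b ^ suc p * L′) (littleEndian-suc b p (λ i → c (i ↑ˡ q))) ⟨
      littleEndian b (suc p) (λ i → c (i ↑ˡ q)) + b ^ suc p * L′
    ∎
    where
    open ≡-Reasoning
    L  = littleEndian b p (λ i → c (Fin.suc (i ↑ˡ q)))
    L′ = littleEndian b q (λ j → c (suc p ↑ʳ j))

  bigEndian-append : ∀ b p q (c : Fin (p + q) → ℕ) →
    bigEndian b (p + q) c ≡ bigEndian b p (λ i → c (i ↑ˡ q)) * b ^ q + bigEndian b q (λ j → c (p ↑ʳ j))
  bigEndian-append b zero    q c = refl
  bigEndian-append b (suc p) q c = begin
      c Fin.zero * b ^ (p + q) + bigEndian b (p + q) (λ t → c (Fin.suc t))
    ≡⟨ cong₂ _+_ (cong (c Fin.zero *_) (^-distribˡ-+-* b p q)) (bigEndian-append b p q (λ t → c (Fin.suc t))) ⟩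
      c Fin.zero * (b ^ p * b ^ q) + (B * b ^ q + B′)
    ≡⟨ solve 5 (λ x u v w z → x :* (u :* v) :+ (w :* v :+ z) := (x :* u :+ w) :* v :+ z) refl (c Fin.zero) (b ^ p) (b ^ q) B B′ ⟩
      (c Fin.zero * b ^ p + B) * b ^ q + B′
    ∎
    where
    open ≡-Reasoning
    B  = bigEndian b p (λ i → c (Fin.suc (i ↑ˡ q)))
    B′ = bigEndian b q (λ j → c (suc p ↑ʳ j))

  lowDigit< : ∀ {b B x y} → x < b → y < B → x + b * y < b * B
  lowDigit< {b} {B} {x} {y} x<b y<B = begin-strict
      x + b * y   <⟨ +-monoˡ-< (b * y) x<b ⟩
      b + b * y   ≡⟨ *-suc b y ⟨
      b * suc y   ≤⟨ *-monoʳ-≤ b y<B ⟩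
      b * B       ∎
    where open ≤-Reasoning

  highDigit< : ∀ {b B x y} → x < b → y < B → x * B + y < b * B
  highDigit< {b} {B} {x} {y} x<b y<B = begin-strict
      x * B + y   <⟨ +-monoʳ-< (x * B) y<B ⟩
      x * B + B   ≡⟨ +-comm (x * B) B ⟩
      suc x * B   ≤⟨ *-monoˡ-≤ B x<b ⟩
      b * B       ∎
    where open ≤-Reasoning

  littleEndian< : ∀ b n (c : Fin n → ℕ) → (∀ t → c t < b) → littleEndian b n c < b ^ n
  littleEndian< b zero    c c<b = s≤s z≤n
  littleEndian< b (suc n) c c<b rewrite littleEndian-suc b n c =
    lowDigit< (c<b Fin.zero) (littleEndian< b n (λ t → c (Fin.suc t)) (λ t → c<b (Fin.suc t)))

  bigEndian< : ∀ b n (c : Fin n → ℕ) → (∀ t → c t < b) → bigEndian b n c < b ^ n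
  bigEndian< b zero    c c<b = s≤s z≤n
  bigEndian< b (suc n) c c<b =
    highDigit< (c<b Fin.zero) (bigEndian< b n (λ t → c (Fin.suc t)) (λ t → c<b (Fin.suc t)))

  quotient-unique : ∀ D Y Z r → r < D → Y * D ≤ Z * D + r → Z * D + r < suc Y * D → Y ≡ Z
  quotient-unique D Y Z r r<D lower upper with <-cmp Y Z
  ... | tri≈ _ Y≡Z _ = Y≡Z
  ... | tri< Y<Z _ _ = ⊥-elim (<-irrefl refl (<-≤-trans upper (≤-trans (*-monoˡ-≤ D Y<Z) (m≤m+n (Z * D) r))))
  ... | tri> _ _ Z<Y = ⊥-elim (<-irrefl refl (<-≤-trans (highDigit< (≤-refl {suc Z}) r<D) (≤-trans (*-monoˡ-≤ D Z<Y) lower)))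

  quotient-bounds : ∀ D Y r → r < D → Y * D ≤ Y * D + r × Y * D + r < suc Y * D
  quotient-bounds D Y r r<D = m≤m+n (Y * D) r , subst (Y * D + r <_) (+-comm (Y * D) D) (+-monoʳ-< (Y * D) r<D)

  divMod-unique : ∀ B x y w v → w < B → v < B → x * B + w ≡ y * B + v → x ≡ y × w ≡ v
  divMod-unique B x y w v w<B v<B eq = x≡y , +-cancelˡ-≡ (x * B) w v (trans eq (cong (λ z → z * B + v) (sym x≡y)))
    where
    x≡y : x ≡ y
    x≡y = quotient-unique B x y v v<B (subst (x * B ≤_) eq (m≤m+n (x * B) w)) (subst (_< suc x * B) eq (proj₂ (quotient-bounds B x w w<B)))

module AdicIntervals where
  open import Data.Nat.Base using (_+_; _*_; _^_; _∸_)
  open import Data.Nat.Properties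
  open ≡
  open +-*-Solver
  open DigitExpansion

  scale-suc : ∀ b {n j} → j < n → b ^ (n ∸ j) ≡ b * b ^ (n ∸ suc j)
  scale-suc b {n} {j} j<n = cong (b ^_) (begin
      n ∸ j                ≡⟨ suc-pred (n ∸ j) {{ℕ.>-nonZero (m<n⇒0<n∸m j<n)}} ⟨
      suc (ℕ.pred (n ∸ j)) ≡⟨ cong suc (pred[m∸n]≡m∸[1+n] n j) ⟩
      suc (n ∸ suc j)      ∎)
    where open ≡-Reasoning

  -- The b-adic expansion of N / b^n cut after digit j + 1 (with D = b^(n-j-1)): high holds the
  -- first j digits, digit the next one, low the rest.
  record Cut (b D N : ℕ) : Set where
    field
      high digit low : ℕ
      digit<b : digit < b
      low<D   : low < D
      N≡      : N ≡ (b * high + digit) * D + low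

  module _ {b n j N : ℕ} (j<n : j < n) (c : Cut b (b ^ (n ∸ suc j)) N) where
    open Cut c
    private
      D = b ^ (n ∸ suc j)

      N≡high : N ≡ high * (b * D) + (digit * D + low)
      N≡high = trans N≡ (solve 5 (λ b X x D r → (b :* X :+ x) :* D :+ r := X :* (b :* D) :+ (x :* D :+ r)) refl b high digit D low)

    InI⇒≡high : ∀ {m} → InI b n j m N → m ≡ high
    InI⇒≡high {m} (lower , upper) =
      quotient-unique (b * D) m high (digit * D + low) (highDigit< digit<b low<D)
        (subst₂ _≤_ (cong (m *_) (scale-suc b j<n)) N≡high lower)
        (subst₂ _<_ N≡high (cong (suc m *_) (scale-suc b j<n)) upper)

    ≡high⇒InI : ∀ {m} → m ≡ high → InI b n j m N
    ≡high⇒InI refl with quotient-bounds (b * D) high (digit * D + low) (highDigit< digit<b low<D)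
    ... | lower , upper =
      subst₂ _≤_ (cong (high *_) (sym (scale-suc b j<n))) (sym N≡high) lower ,
      subst₂ _<_ (sym N≡high) (cong (suc high *_) (sym (scale-suc b j<n))) upper

    InIk⇒≡digit : ∀ {k} → InIk b n j high k N → k ≡ digit
    InIk⇒≡digit {k} (lower , upper) =
      +-cancelˡ-≡ (b * high) k digit
        (quotient-unique D (b * high + k) (b * high + digit) low low<D (subst (_ ≤_) N≡ lower) (subst (_< _) N≡ upper))

    digit-InIk : InIk b n j high digit N
    digit-InIk with quotient-bounds D (b * high + digit) low low<D
    ... | lower , upper = subst (_ ≤_) (sym N≡) lower , subst (_< _) (sym N≡) upper

module IntegerSolver {c ℓ} (R : CommutativeRing c ℓ) where
  open CommutativeRing R
  open FieldDefs R
  open SemiringMult semiring using (×-homo-+; ×1-homo-*) renaming (_×_ to _×ᵤ_)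
  open SemiringMultTC semiring using (×ᵤ≈×) renaming (_×_ to _×′_)
  open RingProperties ring using (-1*x≈-x)
  open AbelianGroupProperties +-abelianGroup using (⁻¹-involutive; ε⁻¹≈ε; ⁻¹-∙-comm)
  open import Relation.Binary.Reasoning.Setoid setoid

  fromℕ≡×ᵤ1 : ∀ n → fromℕ n ≡ n ×ᵤ 1#
  fromℕ≡×ᵤ1 zero    = ≡.refl
  fromℕ≡×ᵤ1 (suc n) = ≡.cong (1# +_) (fromℕ≡×ᵤ1 n)

  fromℕ-+ : ∀ m n → fromℕ (m ℕ.+ n) ≈ fromℕ m + fromℕ n
  fromℕ-+ m n rewrite fromℕ≡×ᵤ1 (m ℕ.+ n) | fromℕ≡×ᵤ1 m | fromℕ≡×ᵤ1 n = ×-homo-+ 1# m n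

  fromℕ-* : ∀ m n → fromℕ (m ℕ.* n) ≈ fromℕ m * fromℕ n
  fromℕ-* m n rewrite fromℕ≡×ᵤ1 (m ℕ.* n) | fromℕ≡×ᵤ1 m | fromℕ≡×ᵤ1 n = ×1-homo-* m n

  -- Through the optimised ×′ the solver constant con 1ℤ evaluates to 1# itself, not to 1# + 0#.
  fromℤ : ℤ → Carrier
  fromℤ (ℤ.+ n)   = n ×′ 1#
  fromℤ -[1+ n ] = - (suc n ×′ 1#)

  private
    fromℤᵤ : ℤ → Carrier
    fromℤᵤ (ℤ.+ n)   = fromℕ n
    fromℤᵤ -[1+ n ] = - fromℕ (suc n)

    fromℕ≈×′1 : ∀ n → fromℕ n ≈ n ×′ 1#
    fromℕ≈×′1 n = trans (reflexive (fromℕ≡×ᵤ1 n)) (×ᵤ≈× n 1#)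

    fromℤ≈fromℤᵤ : ∀ i → fromℤ i ≈ fromℤᵤ i
    fromℤ≈fromℤᵤ (ℤ.+ n)   = sym (fromℕ≈×′1 n)
    fromℤ≈fromℤᵤ -[1+ n ] = -‿cong (sym (fromℕ≈×′1 (suc n)))

    signᴿ-* : ∀ s t → signᴿ (s Sign.* t) ≈ signᴿ s * signᴿ t
    signᴿ-* Sign.+ t      = sym (*-identityˡ _)
    signᴿ-* Sign.- Sign.+ = sym (*-identityʳ _)
    signᴿ-* Sign.- Sign.- = sym (trans (-1*x≈-x (- 1#)) (⁻¹-involutive 1#))

    fromℤᵤ-◃ : ∀ s n → fromℤᵤ (s ℤ.◃ n) ≈ signᴿ s * fromℕ n
    fromℤᵤ-◃ s      zero    = sym (zeroʳ _)
    fromℤᵤ-◃ Sign.+ (suc n) = sym (*-identityˡ _)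
    fromℤᵤ-◃ Sign.- (suc n) = sym (-1*x≈-x _)

    fromℤᵤ-sign-abs : ∀ i → fromℤᵤ i ≈ signᴿ (ℤ.sign i) * fromℕ ℤ.∣ i ∣
    fromℤᵤ-sign-abs i = trans (reflexive (≡.cong fromℤᵤ (≡.sym (ℤ.◃-inverse i)))) (fromℤᵤ-◃ (ℤ.sign i) ℤ.∣ i ∣)

    fromℤᵤ-* : ∀ i j → fromℤᵤ (i ℤ.* j) ≈ fromℤᵤ i * fromℤᵤ j
    fromℤᵤ-* i j = begin
        fromℤᵤ (ℤ.sign i Sign.* ℤ.sign j ℤ.◃ ℤ.∣ i ∣ ℕ.* ℤ.∣ j ∣)
      ≈⟨ fromℤᵤ-◃ (ℤ.sign i Sign.* ℤ.sign j) (ℤ.∣ i ∣ ℕ.* ℤ.∣ j ∣) ⟩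
        signᴿ (ℤ.sign i Sign.* ℤ.sign j) * fromℕ (ℤ.∣ i ∣ ℕ.* ℤ.∣ j ∣)
      ≈⟨ *-cong (signᴿ-* (ℤ.sign i) (ℤ.sign j)) (fromℕ-* ℤ.∣ i ∣ ℤ.∣ j ∣) ⟩
        (signᴿ (ℤ.sign i) * signᴿ (ℤ.sign j)) * (fromℕ ℤ.∣ i ∣ * fromℕ ℤ.∣ j ∣)
      ≈⟨ interchange _ _ _ _ ⟩
        (signᴿ (ℤ.sign i) * fromℕ ℤ.∣ i ∣) * (signᴿ (ℤ.sign j) * fromℕ ℤ.∣ j ∣)
      ≈⟨ *-cong (fromℤᵤ-sign-abs i) (fromℤᵤ-sign-abs j) ⟨
        fromℤᵤ i * fromℤᵤ j
      ∎
      where open CommutativeSemigroupProperties *-commutativeSemigroup using (interchange)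

    fromℤᵤ-⊖ : ∀ m n → fromℤᵤ (m ℤ.⊖ n) ≈ fromℕ m - fromℕ n
    fromℤᵤ-⊖ zero    zero    = sym (-‿inverseʳ 0#)
    fromℤᵤ-⊖ zero    (suc n) = sym (+-identityˡ _)
    fromℤᵤ-⊖ (suc m) zero    = sym (trans (+-congˡ ε⁻¹≈ε) (+-identityʳ _))
    fromℤᵤ-⊖ (suc m) (suc n) = begin
        fromℤᵤ (suc m ℤ.⊖ suc n)      ≡⟨ ≡.cong fromℤᵤ (ℤ.[1+m]⊖[1+n]≡m⊖n m n) ⟩
        fromℤᵤ (m ℤ.⊖ n)              ≈⟨ fromℤᵤ-⊖ m n ⟩
        fromℕ m - fromℕ n            ≈⟨ +-identityˡ _ ⟨
        0# + (fromℕ m - fromℕ n)     ≈⟨ +-congʳ (-‿inverseʳ 1#) ⟨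
        (1# - 1#) + (fromℕ m - fromℕ n) ≈⟨ interchange _ _ _ _ ⟩
        (1# + fromℕ m) + (- 1# - fromℕ n) ≈⟨ +-congˡ (⁻¹-∙-comm 1# (fromℕ n)) ⟩
        (1# + fromℕ m) - (1# + fromℕ n) ∎
      where open CommutativeSemigroupProperties +-commutativeSemigroup using (interchange)

    fromℤᵤ-+ : ∀ i j → fromℤᵤ (i ℤ.+ j) ≈ fromℤᵤ i + fromℤᵤ j
    fromℤᵤ-+ -[1+ m ] -[1+ n ] = begin
        - (1# + (1# + fromℕ (m ℕ.+ n)))     ≈⟨ -‿cong (+-congˡ (+-congˡ (fromℕ-+ m n))) ⟩
        - (1# + (1# + (fromℕ m + fromℕ n))) ≈⟨ -‿cong (+-solve 3 (λ o x y → o ⊕ (o ⊕ (x ⊕ y)) ⊜ (o ⊕ x) ⊕ (o ⊕ y)) refl 1# _ _) ⟩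
        - ((1# + fromℕ m) + (1# + fromℕ n)) ≈⟨ ⁻¹-∙-comm _ _ ⟨
        - (1# + fromℕ m) + - (1# + fromℕ n) ∎
      where open CommutativeMonoidSolver +-commutativeMonoid using (_⊕_; _⊜_) renaming (solve to +-solve)
    fromℤᵤ-+ -[1+ m ] (ℤ.+ n) = trans (fromℤᵤ-⊖ n (suc m)) (+-comm _ _)
    fromℤᵤ-+ (ℤ.+ m) -[1+ n ] = fromℤᵤ-⊖ m (suc n)
    fromℤᵤ-+ (ℤ.+ m) (ℤ.+ n) = fromℕ-+ m n

    fromℤᵤ-neg : ∀ i → fromℤᵤ (ℤ.- i) ≈ - fromℤᵤ i
    fromℤᵤ-neg -[1+ n ]    = sym (⁻¹-involutive _)
    fromℤᵤ-neg (ℤ.+ zero)    = sym ε⁻¹≈ε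
    fromℤᵤ-neg (ℤ.+ (suc n)) = refl

    fromℤ-homomorphism : ℤ.+-*-rawRing -Raw-AlmostCommutative⟶ fromCommutativeRing R
    fromℤ-homomorphism = record
      { ⟦_⟧    = fromℤ
      ; +-homo = λ i j → transport (i ℤ.+ j) (fromℤᵤ-+ i j) (+-cong (fromℤ≈fromℤᵤ i) (fromℤ≈fromℤᵤ j))
      ; *-homo = λ i j → transport (i ℤ.* j) (fromℤᵤ-* i j) (*-cong (fromℤ≈fromℤᵤ i) (fromℤ≈fromℤᵤ j))
      ; -‿homo = λ i → transport (ℤ.- i) (fromℤᵤ-neg i) (-‿cong (fromℤ≈fromℤᵤ i))
      ; 0-homo = refl
      ; 1-homo = refl
      }
      where
      transport : ∀ i {x y} → fromℤᵤ i ≈ x → y ≈ x → fromℤ i ≈ y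
      transport i eq y≈x = trans (fromℤ≈fromℤᵤ i) (trans eq (sym y≈x))

    fromℤ-≟ : ∀ i j → Maybe (fromℤ i ≈ fromℤ j)
    fromℤ-≟ i j with i ℤ.≟ j
    ... | yes ≡.refl = just refl
    ... | no _       = nothing

  open Algebra.Solver.Ring ℤ.+-*-rawRing (fromCommutativeRing R) fromℤ-homomorphism fromℤ-≟ public

module Summation {c ℓ} (R : CommutativeRing c ℓ) where
  open CommutativeRing R
  open FieldDefs R
  open IntegerSolver R
  open SemiringSum semiring using (sum; sum-cong-≗; ∑-distrib-+; ∑-comm; *-distribˡ-sum; sum-permute)
  open SemiringExp semiring using (_^_; ^-homo-*; ^-assocʳ)
  open DigitExpansion using (append)
  open import Relation.Binary.Reasoning.Setoid setoid

  ∑≡sum : ∀ n (f : Fin n → Carrier) → ∑ n f ≡ sum f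
  ∑≡sum zero    f = ≡.refl
  ∑≡sum (suc n) f = ≡.cong (f Fin.zero +_) (∑≡sum n (λ i → f (Fin.suc i)))

  ∑∑≡sumsum : ∀ m n (f : Fin m → Fin n → Carrier) → ∑ m (λ i → ∑ n (f i)) ≡ sum (λ i → sum (f i))
  ∑∑≡sumsum m n f = ≡.trans (∑≡sum m _) (sum-cong-≗ (λ i → ∑≡sum n (f i)))

  ∑-cong : ∀ n {f g : Fin n → Carrier} → (∀ i → f i ≈ g i) → ∑ n f ≈ ∑ n g
  ∑-cong zero    f≈g = refl
  ∑-cong (suc n) f≈g = +-cong (f≈g Fin.zero) (∑-cong n (λ i → f≈g (Fin.suc i)))

  ∑-zero : ∀ n → ∑ n (λ _ → 0#) ≈ 0#
  ∑-zero zero    = refl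
  ∑-zero (suc n) = trans (+-identityˡ _) (∑-zero n)

  ∑-const : ∀ n x → ∑ n (λ _ → x) ≈ fromℕ n * x
  ∑-const zero    x = sym (zeroˡ x)
  ∑-const (suc n) x = begin
      x + ∑ n (λ _ → x)      ≈⟨ +-congˡ (∑-const n x) ⟩
      x + fromℕ n * x        ≈⟨ +-congʳ (*-identityˡ x) ⟨
      1# * x + fromℕ n * x   ≈⟨ distribʳ x 1# (fromℕ n) ⟨
      (1# + fromℕ n) * x     ∎

  ∑-+ : ∀ n (f g : Fin n → Carrier) → ∑ n (λ i → f i + g i) ≈ ∑ n f + ∑ n g
  ∑-+ n f g = begin
      ∑ n (λ i → f i + g i)   ≡⟨ ∑≡sum n _ ⟩
      sum (λ i → f i + g i)   ≈⟨ ∑-distrib-+ f g ⟩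
      sum f + sum g           ≡⟨ ≡.cong₂ _+_ (∑≡sum n f) (∑≡sum n g) ⟨
      ∑ n f + ∑ n g           ∎

  ∑-*ˡ : ∀ n x (f : Fin n → Carrier) → x * ∑ n f ≈ ∑ n (λ i → x * f i)
  ∑-*ˡ n x f = begin
      x * ∑ n f               ≡⟨ ≡.cong (x *_) (∑≡sum n f) ⟩
      x * sum f               ≈⟨ *-distribˡ-sum x f ⟩
      sum (λ i → x * f i)     ≡⟨ ∑≡sum n _ ⟨
      ∑ n (λ i → x * f i)     ∎

  ∑-*ʳ : ∀ n x (f : Fin n → Carrier) → ∑ n f * x ≈ ∑ n (λ i → f i * x)
  ∑-*ʳ n x f = trans (*-comm _ x) (trans (∑-*ˡ n x f) (∑-cong n (λ i → *-comm x (f i))))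

  ∑-neg : ∀ n (f : Fin n → Carrier) → ∑ n (λ i → - f i) ≈ - ∑ n f
  ∑-neg zero    f = sym (trans (sym (+-identityˡ _)) (-‿inverseʳ 0#))
  ∑-neg (suc n) f = trans (+-congˡ (∑-neg n (λ i → f (Fin.suc i))))
    (solve 2 (λ a b → :- a :+ :- b := :- (a :+ b)) refl _ _)

  ∑-swap : ∀ m n (f : Fin m → Fin n → Carrier) → ∑ m (λ i → ∑ n (f i)) ≈ ∑ n (λ j → ∑ m (λ i → f i j))
  ∑-swap m n f = begin
      ∑ m (λ i → ∑ n (f i))             ≡⟨ ∑∑≡sumsum m n f ⟩
      sum (λ i → sum (f i))             ≈⟨ ∑-comm f ⟩
      sum (λ j → sum (λ i → f i j))     ≡⟨ ∑∑≡sumsum n m (λ j i → f i j) ⟨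
      ∑ n (λ j → ∑ m (λ i → f i j))     ∎

  ∑-permute : ∀ n (π : Permutation n n) (f : Fin n → Carrier) → ∑ n (λ i → f (π ⟨$⟩ʳ i)) ≈ ∑ n f
  ∑-permute n π f = begin
      ∑ n (λ i → f (π ⟨$⟩ʳ i))   ≡⟨ ∑≡sum n _ ⟩
      sum (λ i → f (π ⟨$⟩ʳ i))   ≈⟨ sum-permute f π ⟨
      sum f                     ≡⟨ ∑≡sum n f ⟨
      ∑ n f                     ∎

  ^ᴿ≡^ : ∀ x n → x ^ᴿ n ≡ x ^ n
  ^ᴿ≡^ x zero    = ≡.refl
  ^ᴿ≡^ x (suc n) = ≡.cong (x *_) (^ᴿ≡^ x n)

  ^ᴿ-cong : ∀ n {x y} → x ≈ y → x ^ᴿ n ≈ y ^ᴿ n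
  ^ᴿ-cong zero    x≈y = refl
  ^ᴿ-cong (suc n) x≈y = *-cong x≈y (^ᴿ-cong n x≈y)

  ^ᴿ-homo-* : ∀ x m n → x ^ᴿ (m ℕ.+ n) ≈ x ^ᴿ m * x ^ᴿ n
  ^ᴿ-homo-* x m n rewrite ^ᴿ≡^ x (m ℕ.+ n) | ^ᴿ≡^ x m | ^ᴿ≡^ x n = ^-homo-* x m n

  ^ᴿ-assocʳ : ∀ x m n → (x ^ᴿ m) ^ᴿ n ≈ x ^ᴿ (m ℕ.* n)
  ^ᴿ-assocʳ x m n rewrite ^ᴿ≡^ (x ^ᴿ m) n | ^ᴿ≡^ x m | ^ᴿ≡^ x (m ℕ.* n) = ^-assocʳ x m n

  1^ᴿ : ∀ n → 1# ^ᴿ n ≈ 1#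
  1^ᴿ zero    = refl
  1^ᴿ (suc n) = trans (*-identityˡ _) (1^ᴿ n)

  indicator-yes : ∀ {P : Set} (d : Dec P) {x} → P → [ d ]· x ≈ x
  indicator-yes (yes _) p = refl
  indicator-yes (no ¬p) p = ⊥-elim (¬p p)

  indicator-no : ∀ {P : Set} (d : Dec P) {x} → ¬ P → [ d ]· x ≈ 0#
  indicator-no (yes p) ¬p = ⊥-elim (¬p p)
  indicator-no (no _)  ¬p = refl

  indicator-cong : ∀ {P Q : Set} (d : Dec P) (e : Dec Q) {x y} →
                   (P → Q) → (Q → P) → (P → x ≈ y) → [ d ]· x ≈ [ e ]· y
  indicator-cong (yes p) e P⇒Q Q⇒P x≈y = trans (x≈y p) (sym (indicator-yes e (P⇒Q p)))
  indicator-cong (no ¬p) e P⇒Q Q⇒P x≈y = sym (indicator-no e (λ q → ¬p (Q⇒P q)))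

  indicator-congʳ : ∀ {P : Set} (d : Dec P) {x y} → x ≈ y → [ d ]· x ≈ [ d ]· y
  indicator-congʳ (yes _) x≈y = x≈y
  indicator-congʳ (no _)  x≈y = refl

  indicator-× : ∀ {P Q : Set} (d : Dec P) (e : Dec Q) {x} → [ d ×-dec e ]· x ≈ [ d ]· ([ e ]· x)
  indicator-× (yes _) (yes _) = refl
  indicator-× (yes _) (no _)  = refl
  indicator-× (no _)  e       = refl

  ∑-indicator : ∀ {P : Set} (d : Dec P) n (f : Fin n → Carrier) → ∑ n (λ i → [ d ]· f i) ≈ [ d ]· ∑ n f
  ∑-indicator (yes _) n f = refl
  ∑-indicator (no _)  n f = ∑-zero n

  ∑-select : ∀ n {Q : Fin n → Set} (Q? : ∀ k → Dec (Q k)) k₀ → (∀ k → Q k → k ≡ k₀) → Q k₀ →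
             (g : Fin n → Carrier) → ∑ n (λ k → [ Q? k ]· g k) ≈ g k₀
  ∑-select (suc n) Q? Fin.zero only q₀ g = begin
      [ Q? Fin.zero ]· g Fin.zero + ∑ n (λ k → [ Q? (Fin.suc k) ]· g (Fin.suc k))
    ≈⟨ +-cong (indicator-yes (Q? Fin.zero) q₀) (∑-cong n (λ k → indicator-no (Q? (Fin.suc k)) (λ q → Fin.0≢1+n (≡.sym (only _ q))))) ⟩
      g Fin.zero + ∑ n (λ _ → 0#)
    ≈⟨ +-congˡ (∑-zero n) ⟩
      g Fin.zero + 0#
    ≈⟨ +-identityʳ _ ⟩
      g Fin.zero
    ∎
  ∑-select (suc n) Q? (Fin.suc k₀) only q₀ g = begin
      [ Q? Fin.zero ]· g Fin.zero + ∑ n (λ k → [ Q? (Fin.suc k) ]· g (Fin.suc k))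
    ≈⟨ +-congʳ (indicator-no (Q? Fin.zero) (λ q → Fin.0≢1+n (only _ q))) ⟩
      0# + ∑ n (λ k → [ Q? (Fin.suc k) ]· g (Fin.suc k))
    ≈⟨ +-identityˡ _ ⟩
      ∑ n (λ k → [ Q? (Fin.suc k) ]· g (Fin.suc k))
    ≈⟨ ∑-select n (λ k → Q? (Fin.suc k)) k₀ (λ k q → Fin.suc-injective (only _ q)) q₀ (λ k → g (Fin.suc k)) ⟩
      g (Fin.suc k₀)
    ∎

  module DigitSums (b : ℕ) where

    ∑digits-cong : ∀ n {f g : (Fin n → Fin b) → Carrier} → (∀ a → f a ≈ g a) → ∑digits b n f ≈ ∑digits b n g
    ∑digits-cong zero    f≈g = f≈g _
    ∑digits-cong (suc n) f≈g = ∑-cong b (λ d → ∑digits-cong n (λ a → f≈g (d ∷ a)))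

    ∑digits-+ : ∀ n (f g : (Fin n → Fin b) → Carrier) → ∑digits b n (λ a → f a + g a) ≈ ∑digits b n f + ∑digits b n g
    ∑digits-+ zero    f g = refl
    ∑digits-+ (suc n) f g = trans (∑-cong b (λ d → ∑digits-+ n _ _)) (∑-+ b _ _)

    ∑digits-*ˡ : ∀ n x (f : (Fin n → Fin b) → Carrier) → x * ∑digits b n f ≈ ∑digits b n (λ a → x * f a)
    ∑digits-*ˡ zero    x f = refl
    ∑digits-*ˡ (suc n) x f = trans (∑-*ˡ b x _) (∑-cong b (λ d → ∑digits-*ˡ n x _))

    ∑digits-*ʳ : ∀ n x (f : (Fin n → Fin b) → Carrier) → ∑digits b n f * x ≈ ∑digits b n (λ a → f a * x)
    ∑digits-*ʳ n x f = trans (*-comm _ x) (trans (∑digits-*ˡ n x f) (∑digits-cong n (λ a → *-comm x (f a))))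

    ∑digits-const : ∀ n x → ∑digits b n (λ _ → x) ≈ fromℕ (b ℕ.^ n) * x
    ∑digits-const zero    x = sym (trans (*-congʳ (+-identityʳ 1#)) (*-identityˡ x))
    ∑digits-const (suc n) x = begin
        ∑ b (λ _ → ∑digits b n (λ _ → x))   ≈⟨ ∑-cong b (λ _ → ∑digits-const n x) ⟩
        ∑ b (λ _ → fromℕ (b ℕ.^ n) * x)     ≈⟨ ∑-const b _ ⟩
        fromℕ b * (fromℕ (b ℕ.^ n) * x)     ≈⟨ *-assoc _ _ _ ⟨
        fromℕ b * fromℕ (b ℕ.^ n) * x       ≈⟨ *-congʳ (fromℕ-* b (b ℕ.^ n)) ⟨
        fromℕ (b ℕ.^ suc n) * x             ∎

    ∑digits-indicator : ∀ {P : Set} (d : Dec P) n (f : (Fin n → Fin b) → Carrier) →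
                        ∑digits b n (λ a → [ d ]· f a) ≈ [ d ]· ∑digits b n f
    ∑digits-indicator (yes _) n f = refl
    ∑digits-indicator (no _)  n f = trans (∑digits-const n 0#) (zeroʳ _)

    ∑-∑digits : ∀ m n (f : Fin m → (Fin n → Fin b) → Carrier) →
                ∑ m (λ i → ∑digits b n (f i)) ≈ ∑digits b n (λ a → ∑ m (λ i → f i a))
    ∑-∑digits m zero    f = refl
    ∑-∑digits m (suc n) f = trans (∑-swap m b _) (∑-cong b (λ d → ∑-∑digits m n (λ i a → f i (d ∷ a))))

    ∑digits-swap : ∀ m n (f : (Fin m → Fin b) → (Fin n → Fin b) → Carrier) →
                   ∑digits b m (λ x → ∑digits b n (f x)) ≈ ∑digits b n (λ y → ∑digits b m (λ x → f x y))
    ∑digits-swap zero    n f = refl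
    ∑digits-swap (suc m) n f = trans (∑-cong b (λ d → ∑digits-swap m n (λ x → f (d ∷ x))))
                                     (∑-∑digits b n (λ d y → ∑digits b m (λ x → f (d ∷ x) y)))

    ∑digits-append : ∀ p q (f : (Fin (p ℕ.+ q) → Fin b) → Carrier) →
                     ∑digits b (p ℕ.+ q) f ≈ ∑digits b p (λ x → ∑digits b q (λ y → f (append p x y)))
    ∑digits-append zero    q f = refl
    ∑digits-append (suc p) q f = ∑-cong b (λ d → ∑digits-append p q (λ a → f (d ∷ a)))

module GeometricSums {c ℓ} (R : CommutativeRing c ℓ) where
  open CommutativeRing R
  open FieldDefs R
  open IntegerSolver R
  open Summation R
  open import Relation.Binary.Reasoning.Setoid setoid

  geometric : Carrier → ℕ → ℕ → Carrier
  geometric x l k = ∑ k (λ r → x ^ᴿ (toℕ r ℕ.* l))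

  geometric-telescopes : ∀ x l k → geometric x l k * (x ^ᴿ l - 1#) ≈ x ^ᴿ (k ℕ.* l) - 1#
  geometric-telescopes x l zero    = trans (zeroˡ _) (sym (-‿inverseʳ 1#))
  geometric-telescopes x l (suc k) = begin
      (1# + ∑ k (λ r → x ^ᴿ (l ℕ.+ toℕ r ℕ.* l))) * (w - 1#)
    ≈⟨ *-congʳ (+-congˡ (trans (∑-cong k (λ r → ^ᴿ-homo-* x l (toℕ r ℕ.* l))) (sym (∑-*ˡ k w _)))) ⟩
      (1# + w * g) * (w - 1#)
    ≈⟨ solve 2 (λ w g → (Κ1 :+ w :* g) :* (w :- Κ1) := (w :- Κ1) :+ w :* (g :* (w :- Κ1))) refl w g ⟩
      (w - 1#) + w * (g * (w - 1#))
    ≈⟨ +-congˡ (*-congˡ (geometric-telescopes x l k)) ⟩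
      (w - 1#) + w * (x ^ᴿ (k ℕ.* l) - 1#)
    ≈⟨ solve 2 (λ w u → (w :- Κ1) :+ w :* (u :- Κ1) := w :* u :- Κ1) refl w (x ^ᴿ (k ℕ.* l)) ⟩
      w * x ^ᴿ (k ℕ.* l) - 1#
    ≈⟨ +-congʳ (^ᴿ-homo-* x l (k ℕ.* l)) ⟨
      x ^ᴿ (suc k ℕ.* l) - 1#
    ∎
    where
    w = x ^ᴿ l
    g = geometric x l k
    Κ1 = con ℤ.1ℤ

module FieldFacts {c ℓ} (R : CommutativeRing c ℓ) (inv : CommutativeRing.Carrier R → CommutativeRing.Carrier R)
                  (isInverse : FieldDefs.IsInverse R inv) (charZero : FieldDefs.CharZero R) where
  open CommutativeRing R
  open FieldDefs R
  open IntegerSolver R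
  open import Relation.Binary.Reasoning.Setoid setoid

  1≉0 : ¬ (1# ≈ 0#)
  1≉0 1≈0 = charZero 0 (trans (+-identityʳ 1#) 1≈0)

  unit⇒≉0 : ∀ {x y} → x * y ≈ 1# → ¬ (x ≈ 0#)
  unit⇒≉0 {x} {y} xy≈1 x≈0 = 1≉0 (trans (sym xy≈1) (trans (*-congʳ x≈0) (zeroˡ y)))

  inverse-unique : ∀ {x y} → ¬ (x ≈ 0#) → x * y ≈ 1# → y ≈ inv x
  inverse-unique {x} {y} x≉0 xy≈1 = begin
      y                  ≈⟨ *-identityʳ y ⟨
      y * 1#             ≈⟨ *-congˡ (isInverse x x≉0) ⟨
      y * (x * inv x)    ≈⟨ solve 3 (λ x y z → y :* (x :* z) := (x :* y) :* z) refl x y (inv x) ⟩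
      (x * y) * inv x    ≈⟨ *-congʳ xy≈1 ⟩
      1# * inv x         ≈⟨ *-identityˡ _ ⟩
      inv x              ∎

  fromℕ-≉0 : ∀ n → 0 < n → ¬ (fromℕ n ≈ 0#)
  fromℕ-≉0 (suc n) _ = charZero n

  module _ {x y} (x≉0 : ¬ (x ≈ 0#)) (y≉0 : ¬ (y ≈ 0#)) where
    private
      product-inverse : x * y * (inv x * inv y) ≈ 1#
      product-inverse = begin
          x * y * (inv x * inv y)       ≈⟨ solve 4 (λ a b c d → a :* b :* (c :* d) := (a :* c) :* (b :* d)) refl x y (inv x) (inv y) ⟩
          (x * inv x) * (y * inv y)     ≈⟨ *-cong (isInverse x x≉0) (isInverse y y≉0) ⟩
          1# * 1#                       ≈⟨ *-identityˡ 1# ⟩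
          1#                            ∎

    *-≉0 : ¬ (x * y ≈ 0#)
    *-≉0 = unit⇒≉0 product-inverse

    inv-* : inv (x * y) ≈ inv x * inv y
    inv-* = sym (inverse-unique *-≉0 product-inverse)

module RootsOfUnity {c ℓ} (R : CommutativeRing c ℓ) (inv : CommutativeRing.Carrier R → CommutativeRing.Carrier R)
                    (isInverse : FieldDefs.IsInverse R inv) (charZero : FieldDefs.CharZero R)
                    (b : ℕ) (ω : CommutativeRing.Carrier R) (ω-root : FieldDefs.PrimitiveRoot R b ω) where
  open CommutativeRing R
  open FieldDefs R
  open IntegerSolver R
  open Summation R
  open GeometricSums R
  open FieldFacts R inv isInverse charZero
  open GroupProperties +-group using (x∙y⁻¹≈ε⇒x≈y)
  open import Relation.Binary.Reasoning.Setoid setoid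

  ω^[b*l]≈1 : ∀ l → ω ^ᴿ (b ℕ.* l) ≈ 1#
  ω^[b*l]≈1 l = trans (sym (^ᴿ-assocʳ ω b l)) (trans (^ᴿ-cong l (proj₁ ω-root)) (1^ᴿ l))

  ω^[b-t]≈inv[ω^t] : ∀ l t → t ℕ.≤ b → ω ^ᴿ ((b ℕ.∸ t) ℕ.* l) ≈ inv (ω ^ᴿ (t ℕ.* l))
  ω^[b-t]≈inv[ω^t] l t t≤b = inverse-unique (unit⇒≉0 ω^t*ω^[b-t]≈1) ω^t*ω^[b-t]≈1
    where
    ω^t*ω^[b-t]≈1 : ω ^ᴿ (t ℕ.* l) * ω ^ᴿ ((b ℕ.∸ t) ℕ.* l) ≈ 1#
    ω^t*ω^[b-t]≈1 = begin
        ω ^ᴿ (t ℕ.* l) * ω ^ᴿ ((b ℕ.∸ t) ℕ.* l)   ≈⟨ ^ᴿ-homo-* ω (t ℕ.* l) _ ⟨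
        ω ^ᴿ (t ℕ.* l ℕ.+ (b ℕ.∸ t) ℕ.* l)        ≡⟨ ≡.cong (ω ^ᴿ_) (≡.trans (≡.sym (ℕ.*-distribʳ-+ l t (b ℕ.∸ t)))
                                                                    (≡.cong (ℕ._* l) (ℕ.m+[n∸m]≡n t≤b))) ⟩
        ω ^ᴿ (b ℕ.* l)                            ≈⟨ ω^[b*l]≈1 l ⟩
        1#                                        ∎

  module _ {l : ℕ} (0<l : 0 < l) (l<b : l < b) where

    ω^l-1≉0 : ¬ (ω ^ᴿ l - 1# ≈ 0#)
    ω^l-1≉0 ω^l-1≈0 = proj₂ ω-root l 0<l l<b (x∙y⁻¹≈ε⇒x≈y _ _ ω^l-1≈0)

    geometric-closed : ∀ k → geometric ω l k ≈ (ω ^ᴿ (k ℕ.* l) - 1#) * inv (ω ^ᴿ l - 1#)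
    geometric-closed k = begin
        geometric ω l k                                 ≈⟨ *-identityʳ _ ⟨
        geometric ω l k * 1#                            ≈⟨ *-congˡ (isInverse _ ω^l-1≉0) ⟨
        geometric ω l k * ((ω ^ᴿ l - 1#) * inv (ω ^ᴿ l - 1#))  ≈⟨ *-assoc _ _ _ ⟨
        geometric ω l k * (ω ^ᴿ l - 1#) * inv (ω ^ᴿ l - 1#)    ≈⟨ *-congʳ (geometric-telescopes ω l k) ⟩
        (ω ^ᴿ (k ℕ.* l) - 1#) * inv (ω ^ᴿ l - 1#)      ∎

    ∑-roots≈0 : ∑ b (λ k → ω ^ᴿ (toℕ k ℕ.* l)) ≈ 0#
    ∑-roots≈0 = begin
        geometric ω l b                               ≈⟨ geometric-closed b ⟩
        (ω ^ᴿ (b ℕ.* l) - 1#) * inv (ω ^ᴿ l - 1#)     ≈⟨ *-congʳ (+-congʳ (ω^[b*l]≈1 l)) ⟩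
        (1# - 1#) * inv (ω ^ᴿ l - 1#)                 ≈⟨ *-congʳ (-‿inverseʳ 1#) ⟩
        0# * inv (ω ^ᴿ l - 1#)                        ≈⟨ zeroˡ _ ⟩
        0#                                            ∎

    ∑-geometric : ∑ b (λ k → geometric ω l (toℕ k)) ≈ - (fromℕ b * inv (ω ^ᴿ l - 1#))
    ∑-geometric = begin
        ∑ b (λ k → geometric ω l (toℕ k))
      ≈⟨ ∑-cong b (λ k → trans (geometric-closed (toℕ k)) (solve 2 (λ u q → (u :- Κ1) :* q := u :* q :+ :- q) refl _ q)) ⟩
        ∑ b (λ k → ω ^ᴿ (toℕ k ℕ.* l) * q + - q)
      ≈⟨ ∑-+ b _ _ ⟩
        ∑ b (λ k → ω ^ᴿ (toℕ k ℕ.* l) * q) + ∑ b (λ _ → - q)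
      ≈⟨ +-cong (∑-*ʳ b q _) (sym (∑-neg b (λ _ → q))) ⟨
        ∑ b (λ k → ω ^ᴿ (toℕ k ℕ.* l)) * q + - ∑ b (λ _ → q)
      ≈⟨ +-cong (trans (*-congʳ ∑-roots≈0) (zeroˡ q)) (-‿cong (∑-const b q)) ⟩
        0# + - (fromℕ b * q)
      ≈⟨ +-identityˡ _ ⟩
        - (fromℕ b * q)
      ∎
      where
      q = inv (ω ^ᴿ l - 1#)
      Κ1 = con ℤ.1ℤ

choosePermutation : ∀ {b} → Permutation b b → Bool → Permutation b b
choosePermutation σ true  = σ
choosePermutation σ false = σ ∘ₚ Perm.reverse

choosePermutation-⟨$⟩ʳ : ∀ {b} (σ : Permutation b b) p k → choosePermutation σ p ⟨$⟩ʳ k ≡ choose σ p k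
choosePermutation-⟨$⟩ʳ σ true  k = ≡.refl
choosePermutation-⟨$⟩ʳ σ false k = ≡.refl

signOf : Bool → Sign
signOf true  = Sign.+
signOf false = Sign.-

module Counting {c ℓ} (R : CommutativeRing c ℓ) (b : ℕ) (0<b : 0 < b) where
  open CommutativeRing R
  open FieldDefs R
  open Summation R
  open DigitSums b
  open DigitExpansion
  open import Relation.Binary.Reasoning.Setoid setoid

  instance
    b≢0 : ℕ.NonZero b
    b≢0 = ℕ.>-nonZero 0<b

  count-digit : ∀ (π : Permutation b b) {r} → r < b → ∀ x → ∑ b (λ d → [ toℕ (π ⟨$⟩ʳ d) ≟ r ]· x) ≈ x
  count-digit π {r} r<b x = trans (∑-permute b π (λ k → [ toℕ k ≟ r ]· x))
    (∑-select b (λ k → toℕ k ≟ r) (Fin.fromℕ< r<b)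
      (λ k k≡r → Fin.toℕ-injective (≡.trans k≡r (≡.sym (Fin.toℕ-fromℕ< r<b)))) (Fin.toℕ-fromℕ< r<b) (λ _ → x))

  count-combine : ∀ j {x m q r} (value : Fin b → (Fin j → Fin b) → ℕ) (u : Fin b → ℕ) (v : (Fin j → Fin b) → ℕ) →
                  (∀ d a → value d a ≡ m → u d ≡ q × v a ≡ r) → (∀ d a → u d ≡ q → v a ≡ r → value d a ≡ m) →
                  ∑ b (λ d → [ u d ≟ q ]· x) ≈ x → ∑digits b j (λ a → [ v a ≟ r ]· x) ≈ x →
                  ∑ b (λ d → ∑digits b j (λ a → [ value d a ≟ m ]· x)) ≈ x
  count-combine j {x} {m} {q} {r} value u v split join count-u count-v = begin
      ∑ b (λ d → ∑digits b j (λ a → [ value d a ≟ m ]· x))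
    ≈⟨ ∑-cong b (λ d → ∑digits-cong j (λ a → trans
         (indicator-cong (value d a ≟ m) (u d ≟ q ×-dec v a ≟ r) (split d a) (λ (eu , ev) → join d a eu ev) (λ _ → refl))
         (indicator-× (u d ≟ q) (v a ≟ r)))) ⟩
      ∑ b (λ d → ∑digits b j (λ a → [ u d ≟ q ]· ([ v a ≟ r ]· x)))
    ≈⟨ ∑-cong b (λ d → trans (∑digits-indicator (u d ≟ q) j _) (indicator-congʳ (u d ≟ q) count-v)) ⟩
      ∑ b (λ d → [ u d ≟ q ]· x)
    ≈⟨ count-u ⟩
      x
    ∎

  count-bigEndian : ∀ j {m} → m < b ℕ.^ j → ∀ x → ∑digits b j (λ a → [ bigEndian b j (λ t → toℕ (a t)) ≟ m ]· x) ≈ x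
  count-bigEndian zero    {zero}  _         x = refl
  count-bigEndian zero    {suc m} (s≤s ())  x
  count-bigEndian (suc j) {m}     m<b^[1+j] x =
    count-combine j (λ d a → toℕ d ℕ.* B ℕ.+ value a) toℕ value
      (λ d a eq → divMod-unique B (toℕ d) q (value a) r (bigEndian< b j _ (λ t → Fin.toℕ<n (a t))) r<B (≡.trans eq m≡))
      (λ d a eu ev → ≡.trans (≡.cong₂ (λ u v → u ℕ.* B ℕ.+ v) eu ev) (≡.sym m≡))
      (count-digit Perm.id q<b x) (count-bigEndian j r<B x)
    where
    B = b ℕ.^ j
    instance
      B≢0 : ℕ.NonZero B
      B≢0 = ℕ.m^n≢0 b j
    q = m / B
    r = m % B
    value : (Fin j → Fin b) → ℕ
    value a = bigEndian b j (λ t → toℕ (a t))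
    r<B : r < B
    r<B = m%n<n m B
    q<b : q < b
    q<b = m<n*o⇒m/o<n m<b^[1+j]
    m≡ : m ≡ q ℕ.* B ℕ.+ r
    m≡ = ≡.trans (m≡m%n+[m/n]*n m B) (ℕ.+-comm r (q ℕ.* B))

  count-littleEndian : ∀ j (π : Fin j → Permutation b b) {m} → m < b ℕ.^ j → ∀ x →
                       ∑digits b j (λ a → [ littleEndian b j (λ t → toℕ (π t ⟨$⟩ʳ a t)) ≟ m ]· x) ≈ x
  count-littleEndian zero    π {zero}  _         x = refl
  count-littleEndian zero    π {suc m} (s≤s ())  x
  count-littleEndian (suc j) π {m}     m<b^[1+j] x =
    count-combine j (λ d a → littleEndian b (suc j) (λ t → toℕ (π t ⟨$⟩ʳ (d ∷ a) t))) (λ d → toℕ (π Fin.zero ⟨$⟩ʳ d)) value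
      (λ d a eq → swap-sym (divMod-unique b q (value a) r (toℕ (π Fin.zero ⟨$⟩ʳ d)) r<b (Fin.toℕ<n _)
                    (≡.trans (≡.sym m≡) (≡.trans (≡.sym eq) (split d a)))))
      (λ d a eu ev → ≡.trans (split d a) (≡.trans (≡.cong₂ (λ u v → v ℕ.* b ℕ.+ u) eu ev) (≡.sym m≡)))
      (count-digit (π Fin.zero) r<b x) (count-littleEndian j (λ t → π (Fin.suc t)) q<b^j x)
    where
    q = m / b
    r = m % b
    swap-sym : ∀ {A : Set} {w x y z : A} → w ≡ x × y ≡ z → z ≡ y × x ≡ w
    swap-sym (w≡x , y≡z) = ≡.sym y≡z , ≡.sym w≡x
    value : (Fin j → Fin b) → ℕ
    value a = littleEndian b j (λ t → toℕ (π (Fin.suc t) ⟨$⟩ʳ a t))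
    split : ∀ d a → littleEndian b (suc j) (λ t → toℕ (π t ⟨$⟩ʳ (d ∷ a) t)) ≡ value a ℕ.* b ℕ.+ toℕ (π Fin.zero ⟨$⟩ʳ d)
    split d a = ≡.trans (littleEndian-suc b j (λ t → toℕ (π t ⟨$⟩ʳ (d ∷ a) t)))
                        (≡.trans (ℕ.+-comm (toℕ (π Fin.zero ⟨$⟩ʳ d)) _) (≡.cong (ℕ._+ toℕ (π Fin.zero ⟨$⟩ʳ d)) (ℕ.*-comm b (value a))))
    r<b : r < b
    r<b = m%n<n m b
    q<b^j : q < b ℕ.^ j
    q<b^j = m<n*o⇒m/o<n (ℕ.<-≤-trans m<b^[1+j] (ℕ.≤-reflexive (ℕ.*-comm b (b ℕ.^ j))))
    m≡ : m ≡ q ℕ.* b ℕ.+ r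
    m≡ = ≡.trans (m≡m%n+[m/n]*n m b) (ℕ.+-comm r (q ℕ.* b))

module ChosenDigitSums {c ℓ} (R : CommutativeRing c ℓ) (inv : CommutativeRing.Carrier R → CommutativeRing.Carrier R)
                       (isInverse : FieldDefs.IsInverse R inv) (charZero : FieldDefs.CharZero R)
                       (b : ℕ) (ω : CommutativeRing.Carrier R) (ω-root : FieldDefs.PrimitiveRoot R b ω)
                       (σ : Permutation b b) where
  open CommutativeRing R
  open FieldDefs R
  open IntegerSolver R
  open Summation R
  open RootsOfUnity R inv isInverse charZero b ω ω-root
  open RingProperties ring using (-1*x≈-x)
  open import Relation.Binary.Reasoning.Setoid setoid

  ∑-choose : ∀ p (h : Fin b → Carrier) → ∑ b (λ d → h (choose σ p d)) ≈ ∑ b h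
  ∑-choose p h = trans (∑-cong b (λ d → reflexive (≡.cong h (≡.sym (choosePermutation-⟨$⟩ʳ σ p d)))))
                       (∑-permute b (choosePermutation σ p) h)

  ∑-ω^chosen*digit : ∀ p l → ∑ b (λ d → ω ^ᴿ (toℕ (choose σ p d) ℕ.* l) * fromℕ (toℕ d)) ≈
                             ∑ b (λ k → fromℕ (toℕ (σ ⟨$⟩ˡ k)) * expP inv ω p (toℕ k) l)
  ∑-ω^chosen*digit p l = trans (sym (∑-permute b (Perm.flip σ) _)) (∑-cong b (summand p))
    where
    summand : ∀ p k → ω ^ᴿ (toℕ (choose σ p (σ ⟨$⟩ˡ k)) ℕ.* l) * fromℕ (toℕ (σ ⟨$⟩ˡ k)) ≈
                   fromℕ (toℕ (σ ⟨$⟩ˡ k)) * expP inv ω p (toℕ k) l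
    summand true  k = trans (*-comm _ _) (*-congˡ (reflexive (≡.cong (λ i → ω ^ᴿ (toℕ i ℕ.* l)) (Perm.inverseʳ σ))))
    summand false k = trans (*-comm _ _) (*-congˡ (begin
        ω ^ᴿ (toℕ (Fin.opposite (σ ⟨$⟩ʳ (σ ⟨$⟩ˡ k))) ℕ.* l)  ≡⟨ ≡.cong (λ i → ω ^ᴿ (toℕ (Fin.opposite i) ℕ.* l)) (Perm.inverseʳ σ) ⟩
        ω ^ᴿ (toℕ (Fin.opposite k) ℕ.* l)                  ≡⟨ ≡.cong (λ i → ω ^ᴿ (i ℕ.* l)) (Fin.opposite-prop k) ⟩
        ω ^ᴿ ((b ℕ.∸ suc (toℕ k)) ℕ.* l)                   ≈⟨ ω^[b-t]≈inv[ω^t] l (suc (toℕ k)) (Fin.toℕ<n k) ⟩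
        inv (ω ^ᴿ (suc (toℕ k) ℕ.* l))                     ∎))

  ∑-chosen*ω^digit : ∀ p {l} → 0 < l → l < b →
                     ∑ b (λ d → fromℕ (toℕ (choose σ p d)) * ω ^ᴿ (toℕ d ℕ.* l)) ≈
                     signᴿ (signOf p) * ∑ b (λ k → fromℕ (toℕ (σ ⟨$⟩ʳ k)) * ω ^ᴿ (toℕ k ℕ.* l))
  ∑-chosen*ω^digit true  0<l l<b = sym (*-identityˡ _)
  ∑-chosen*ω^digit false {l} 0<l l<b = begin
      ∑ b (λ d → fromℕ (toℕ (Fin.opposite (σ ⟨$⟩ʳ d))) * ω ^ᴿ (toℕ d ℕ.* l))
    ≈⟨ ∑-cong b (λ d → *-congʳ (fromℕ-opposite (σ ⟨$⟩ʳ d))) ⟩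
      ∑ b (λ d → (top - fromℕ (toℕ (σ ⟨$⟩ʳ d))) * ω ^ᴿ (toℕ d ℕ.* l))
    ≈⟨ ∑-cong b (λ d → solve 3 (λ t s e → (t :- s) :* e := t :* e :+ :- (s :* e)) refl top _ _) ⟩
      ∑ b (λ d → top * ω ^ᴿ (toℕ d ℕ.* l) + - (fromℕ (toℕ (σ ⟨$⟩ʳ d)) * ω ^ᴿ (toℕ d ℕ.* l)))
    ≈⟨ ∑-+ b _ _ ⟩
      ∑ b (λ d → top * ω ^ᴿ (toℕ d ℕ.* l)) + ∑ b (λ d → - (fromℕ (toℕ (σ ⟨$⟩ʳ d)) * ω ^ᴿ (toℕ d ℕ.* l)))
    ≈⟨ +-cong (trans (sym (∑-*ˡ b top _)) (trans (*-congˡ (∑-roots≈0 0<l l<b)) (zeroʳ top))) (∑-neg b _) ⟩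
      0# + - ∑σ
    ≈⟨ trans (+-identityˡ _) (sym (-1*x≈-x ∑σ)) ⟩
      - 1# * ∑σ
    ∎
    where
    ∑σ = ∑ b (λ k → fromℕ (toℕ (σ ⟨$⟩ʳ k)) * ω ^ᴿ (toℕ k ℕ.* l))
    top = fromℕ (b ℕ.∸ 1)
    fromℕ-opposite : ∀ (t : Fin b) → fromℕ (toℕ (Fin.opposite t)) ≈ top - fromℕ (toℕ t)
    fromℕ-opposite t = begin
        fromℕ (toℕ (Fin.opposite t))                            ≈⟨ solve 2 (λ u v → u := (u :+ v) :- v) refl _ (fromℕ (toℕ t)) ⟩
        (fromℕ (toℕ (Fin.opposite t)) + fromℕ (toℕ t)) - fromℕ (toℕ t) ≈⟨ +-congʳ (fromℕ-+ (toℕ (Fin.opposite t)) (toℕ t)) ⟨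
        fromℕ (toℕ (Fin.opposite t) ℕ.+ toℕ t) - fromℕ (toℕ t)  ≡⟨ ≡.cong (λ n → fromℕ n - fromℕ (toℕ t)) (opposite+t t) ⟩
        top - fromℕ (toℕ t)                                     ∎
      where
      opposite+t : ∀ (t : Fin b) → toℕ (Fin.opposite t) ℕ.+ toℕ t ≡ b ℕ.∸ 1
      opposite+t t = ≡.trans (≡.cong (ℕ._+ toℕ t) (≡.trans (Fin.opposite-prop t) (≡.sym (ℕ.∸-+-assoc b 1 (toℕ t)))))
                             (ℕ.m∸n+n≡m (ℕ.suc[m]≤n⇒m≤pred[n] (Fin.toℕ<n t)))

module PointTerms {c ℓ} (R : CommutativeRing c ℓ) (inv : CommutativeRing.Carrier R → CommutativeRing.Carrier R)
                  (isInverse : FieldDefs.IsInverse R inv) (charZero : FieldDefs.CharZero R)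
                  (b : ℕ) (0<b : 0 < b) (ω : CommutativeRing.Carrier R) where
  open CommutativeRing R
  open FieldDefs R
  open IntegerSolver R
  open Summation R
  open GeometricSums R
  open FieldFacts R inv isInverse charZero
  open AdicIntervals
  open import Relation.Binary.Reasoning.Setoid setoid

  cellSum : (n j₁ j₂ m₁ m₂ ℓ₁ ℓ₂ N₁ N₂ : ℕ) → Carrier
  cellSum n j₁ j₂ m₁ m₂ ℓ₁ ℓ₂ N₁ N₂ =
    ∑ b (λ k₁ → ∑ b (λ k₂ →
      [ InIk? b n j₁ m₁ (toℕ k₁) N₁ ×-dec InIk? b n j₂ m₂ (toℕ k₂) N₂ ]·
        (factor inv ω b n j₁ m₁ (toℕ k₁) ℓ₁ N₁ * factor inv ω b n j₂ m₂ (toℕ k₂) ℓ₂ N₂)))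

  pointTerm : (n j₁ j₂ m₁ m₂ ℓ₁ ℓ₂ N₁ N₂ : ℕ) → Carrier
  pointTerm n j₁ j₂ m₁ m₂ ℓ₁ ℓ₂ N₁ N₂ =
    [ InI? b n j₁ m₁ N₁ ×-dec InI? b n j₂ m₂ N₂ ]· cellSum n j₁ j₂ m₁ m₂ ℓ₁ ℓ₂ N₁ N₂

  -- On a cut, b m + k − b^(j+1) z = − low / D.
  digitFactor : (l r D x : ℕ) → Carrier
  digitFactor l r D x = - (fromℕ r * inv (fromℕ D)) * ω ^ᴿ (x ℕ.* l) - geometric ω l x

  module _ {n j N : ℕ} (j<n : j < n) (cut : Cut b (b ℕ.^ (n ℕ.∸ suc j)) N) where
    open Cut cut
    private
      D = b ℕ.^ (n ℕ.∸ suc j)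

    factor-at-cut : ∀ l → factor inv ω b n j high digit l N ≈ digitFactor l low D digit
    factor-at-cut l = +-congʳ (*-congʳ (begin
        prefix - fromℕ N * ι                        ≈⟨ +-congˡ (-‿cong (*-congʳ N≈)) ⟩
        prefix - (prefix * fromℕ D + fromℕ low) * ι
          ≈⟨ solve 4 (λ p d r ι → p :- (p :* d :+ r) :* ι := :- (r :* ι) :+ p :* (Κ1 :- d :* ι)) refl prefix (fromℕ D) (fromℕ low) ι ⟩
        - (fromℕ low * ι) + prefix * (1# - fromℕ D * ι)  ≈⟨ +-congˡ (*-congˡ (trans (+-congˡ (-‿cong (isInverse _ D≉0))) (-‿inverseʳ 1#))) ⟩
        - (fromℕ low * ι) + prefix * 0#              ≈⟨ trans (+-congˡ (zeroʳ prefix)) (+-identityʳ _) ⟩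
        - (fromℕ low * ι)                           ∎))
      where
      prefix = fromℕ (b ℕ.* high ℕ.+ digit)
      ι = inv (fromℕ D)
      Κ1 = con ℤ.1ℤ
      D≉0 : ¬ (fromℕ D ≈ 0#)
      D≉0 = fromℕ-≉0 D (ℕ.m^n>0 b {{ℕ.>-nonZero 0<b}} (n ℕ.∸ suc j))
      N≈ : fromℕ N ≈ prefix * fromℕ D + fromℕ low
      N≈ = trans (reflexive (≡.cong fromℕ N≡)) (trans (fromℕ-+ ((b ℕ.* high ℕ.+ digit) ℕ.* D) low) (+-congʳ (fromℕ-* (b ℕ.* high ℕ.+ digit) D)))

    ∑-select-digit : (h : Fin b → Carrier) → ∑ b (λ k → [ InIk? b n j high (toℕ k) N ]· h k) ≈ h (Fin.fromℕ< digit<b)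
    ∑-select-digit = ∑-select b (λ k → InIk? b n j high (toℕ k) N) (Fin.fromℕ< digit<b)
      (λ k k∈ → Fin.toℕ-injective (≡.trans (InIk⇒≡digit j<n cut k∈) (≡.sym (Fin.toℕ-fromℕ< digit<b))))
      (≡.subst (λ k → InIk b n j high k N) (≡.sym (Fin.toℕ-fromℕ< digit<b)) (digit-InIk j<n cut))

  module _ {n j₁ j₂ N₁ N₂ : ℕ} (j₁<n : j₁ < n) (j₂<n : j₂ < n)
           (cut₁ : Cut b (b ℕ.^ (n ℕ.∸ suc j₁)) N₁) (cut₂ : Cut b (b ℕ.^ (n ℕ.∸ suc j₂)) N₂) (ℓ₁ ℓ₂ : ℕ) where
    private
      module C₁ = Cut cut₁
      module C₂ = Cut cut₂
      k₁ = Fin.fromℕ< C₁.digit<b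
      k₂ = Fin.fromℕ< C₂.digit<b
      factor₁ factor₂ : Fin b → Carrier
      factor₁ k = factor inv ω b n j₁ C₁.high (toℕ k) ℓ₁ N₁
      factor₂ k = factor inv ω b n j₂ C₂.high (toℕ k) ℓ₂ N₂
      InIk₁? = λ (k : Fin b) → InIk? b n j₁ C₁.high (toℕ k) N₁
      InIk₂? = λ (k : Fin b) → InIk? b n j₂ C₂.high (toℕ k) N₂

    cutFactors : Carrier
    cutFactors = digitFactor ℓ₁ C₁.low (b ℕ.^ (n ℕ.∸ suc j₁)) C₁.digit * digitFactor ℓ₂ C₂.low (b ℕ.^ (n ℕ.∸ suc j₂)) C₂.digit

    cellSum-at-cuts : cellSum n j₁ j₂ C₁.high C₂.high ℓ₁ ℓ₂ N₁ N₂ ≈ cutFactors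
    cellSum-at-cuts = begin
        ∑ b (λ k → ∑ b (λ k′ → [ InIk₁? k ×-dec InIk₂? k′ ]· (factor₁ k * factor₂ k′)))
      ≈⟨ ∑-cong b (λ k → ∑-cong b (λ k′ → indicator-× (InIk₁? k) (InIk₂? k′))) ⟩
        ∑ b (λ k → ∑ b (λ k′ → [ InIk₁? k ]· ([ InIk₂? k′ ]· (factor₁ k * factor₂ k′))))
      ≈⟨ ∑-cong b (λ k → ∑-indicator (InIk₁? k) b _) ⟩
        ∑ b (λ k → [ InIk₁? k ]· ∑ b (λ k′ → [ InIk₂? k′ ]· (factor₁ k * factor₂ k′)))
      ≈⟨ ∑-cong b (λ k → indicator-congʳ (InIk₁? k) (∑-select-digit j₂<n cut₂ (λ k′ → factor₁ k * factor₂ k′))) ⟩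
        ∑ b (λ k → [ InIk₁? k ]· (factor₁ k * factor₂ k₂))
      ≈⟨ ∑-select-digit j₁<n cut₁ (λ k → factor₁ k * factor₂ k₂) ⟩
        factor₁ k₁ * factor₂ k₂
      ≡⟨ ≡.cong₂ (λ x y → factor inv ω b n j₁ C₁.high x ℓ₁ N₁ * factor inv ω b n j₂ C₂.high y ℓ₂ N₂)
                 (Fin.toℕ-fromℕ< C₁.digit<b) (Fin.toℕ-fromℕ< C₂.digit<b) ⟩
        factor inv ω b n j₁ C₁.high C₁.digit ℓ₁ N₁ * factor inv ω b n j₂ C₂.high C₂.digit ℓ₂ N₂
      ≈⟨ *-cong (factor-at-cut j₁<n cut₁ ℓ₁) (factor-at-cut j₂<n cut₂ ℓ₂) ⟩
        cutFactors
      ∎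

    pointTerm-at-cuts : ∀ m₁ m₂ → pointTerm n j₁ j₂ m₁ m₂ ℓ₁ ℓ₂ N₁ N₂ ≈ [ C₂.high ≟ m₂ ]· ([ C₁.high ≟ m₁ ]· cutFactors)
    pointTerm-at-cuts m₁ m₂ = trans
      (indicator-cong (InI? b n j₁ m₁ N₁ ×-dec InI? b n j₂ m₂ N₂) (C₂.high ≟ m₂ ×-dec C₁.high ≟ m₁)
        (λ (in₁ , in₂) → ≡.sym (InI⇒≡high j₂<n cut₂ in₂) , ≡.sym (InI⇒≡high j₁<n cut₁ in₁))
        (λ (e₂ , e₁) → ≡high⇒InI j₁<n cut₁ (≡.sym e₁) , ≡high⇒InI j₂<n cut₂ (≡.sym e₂))
        (λ (in₁ , in₂) → ≡.subst₂ (λ m₁ m₂ → cellSum n j₁ j₂ m₁ m₂ ℓ₁ ℓ₂ N₁ N₂ ≈ cutFactors)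
                           (≡.sym (InI⇒≡high j₁<n cut₁ in₁)) (≡.sym (InI⇒≡high j₂<n cut₂ in₂)) cellSum-at-cuts))
      (indicator-× (C₂.high ≟ m₂) (C₁.high ≟ m₁))

-- A digit vector is assembled as P ++ d₂ ∷ f ++ d₁ ∷ S; numer₂ reads it from the left and numer₁
-- reads its chosen images from the right.
module Decomposition (b : ℕ) (σ : Permutation b b) (j₁ j₂ F : ℕ) (Σ : Fin (j₂ ℕ.+ suc (F ℕ.+ suc j₁)) → Bool) where
  open import Data.Nat.Base using (_+_; _*_; _^_; _∸_)
  open import Data.Nat.Properties
  open ≡
  open DigitExpansion
  open AdicIntervals using (Cut)
  open +-*-Solver

  n : ℕ
  n = j₂ + suc (F + suc j₁)

  assemble : (Fin j₂ → Fin b) → Fin b → (Fin F → Fin b) → Fin b → (Fin j₁ → Fin b) → Fin n → Fin b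
  assemble P d₂ f d₁ S = append j₂ P (d₂ ∷ append F f (d₁ ∷ S))

  posP : Fin j₂ → Fin n
  posP i = i ↑ˡ suc (F + suc j₁)

  pos₂ : Fin n
  pos₂ = j₂ ↑ʳ Fin.zero

  posF : Fin F → Fin n
  posF i = j₂ ↑ʳ Fin.suc (i ↑ˡ suc j₁)

  pos₁ : Fin n
  pos₁ = j₂ ↑ʳ Fin.suc (F ↑ʳ Fin.zero)

  posS : Fin j₁ → Fin n
  posS i = j₂ ↑ʳ Fin.suc (F ↑ʳ Fin.suc i)

  chosen : Fin n → Fin b → ℕ
  chosen t d = toℕ (choose σ (Σ t) d)

  valueP chosenValueP : (Fin j₂ → Fin b) → ℕ
  valueP  P = bigEndian b j₂ (λ i → toℕ (P i))
  chosenValueP P = littleEndian b j₂ (λ i → chosen (posP i) (P i))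

  valueF chosenValueF : (Fin F → Fin b) → ℕ
  valueF  f = bigEndian b F (λ i → toℕ (f i))
  chosenValueF f = littleEndian b F (λ i → chosen (posF i) (f i))

  valueS chosenValueS : (Fin j₁ → Fin b) → ℕ
  valueS  S = bigEndian b j₁ (λ i → toℕ (S i))
  chosenValueS S = littleEndian b j₁ (λ i → chosen (posS i) (S i))

  D₁ D₂ : ℕ
  D₁ = b ^ (n ∸ suc j₁)
  D₂ = b ^ (n ∸ suc j₂)

  n∸[1+j₁]≡j₂+[1+F] : n ∸ suc j₁ ≡ j₂ + suc F
  n∸[1+j₁]≡j₂+[1+F] = trans (cong (_∸ suc j₁) (sym (+-assoc j₂ (suc F) (suc j₁)))) (m+n∸n≡m (j₂ + suc F) (suc j₁))

  n∸[1+j₂]≡F+[1+j₁] : n ∸ suc j₂ ≡ F + suc j₁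
  n∸[1+j₂]≡F+[1+j₁] = trans (cong (_∸ suc j₂) (+-suc j₂ (F + suc j₁))) (m+n∸m≡n j₂ (F + suc j₁))

  n∸[j₁+j₂]≡2+F : n ∸ (j₁ + j₂) ≡ suc (suc F)
  n∸[j₁+j₂]≡2+F = trans (cong (_∸ (j₁ + j₂))
                          (solve 3 (λ j₂ F j₁ → j₂ :+ (con 1 :+ (F :+ (con 1 :+ j₁))) := (con 2 :+ F) :+ (j₁ :+ j₂)) refl j₂ F j₁))
                        (m+n∸n≡m (suc (suc F)) (j₁ + j₂))

  D₁≡ : D₁ ≡ b ^ j₂ * (b * b ^ F)
  D₁≡ = trans (cong (b ^_) n∸[1+j₁]≡j₂+[1+F]) (^-distribˡ-+-* b j₂ (suc F))

  D₂≡ : D₂ ≡ b ^ F * (b * b ^ j₁)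
  D₂≡ = trans (cong (b ^_) n∸[1+j₂]≡F+[1+j₁]) (^-distribˡ-+-* b F (suc j₁))

  j₁<n : j₁ < n
  j₁<n = subst (j₁ <_) (solve 3 (λ j₂ F j₁ → con 1 :+ j₁ :+ (con 1 :+ F :+ j₂) := j₂ :+ (con 1 :+ (F :+ (con 1 :+ j₁)))) refl j₂ F j₁)
               (m≤m+n (suc j₁) (suc F + j₂))

  j₂<n : j₂ < n
  j₂<n = m<m+n j₂ (s≤s z≤n)

  low₁ : (Fin j₂ → Fin b) → Fin b → (Fin F → Fin b) → ℕ
  low₁ P d₂ f = chosenValueP P + b ^ j₂ * (b * chosenValueF f) + b ^ j₂ * chosen pos₂ d₂

  low₂ : (Fin F → Fin b) → Fin b → (Fin j₁ → Fin b) → ℕ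
  low₂ f d₁ S = valueF f * b ^ suc j₁ + valueS S + b ^ j₁ * toℕ d₁

  module _ (P : Fin j₂ → Fin b) (d₂ : Fin b) (f : Fin F → Fin b) (d₁ : Fin b) (S : Fin j₁ → Fin b) where
    private
      a = assemble P d₂ f d₁ S
      a′ = d₂ ∷ append F f (d₁ ∷ S)
      a-posP : ∀ i → a (posP i) ≡ P i
      a-posP = append-↑ˡ j₂ P a′
      a-tail : ∀ j → a (j₂ ↑ʳ j) ≡ a′ j
      a-tail = append-↑ʳ j₂ P a′
      a-posF : ∀ i → a (posF i) ≡ f i
      a-posF i = trans (a-tail _) (append-↑ˡ F f (d₁ ∷ S) i)
      a-pos₁ : a pos₁ ≡ d₁
      a-pos₁ = trans (a-tail _) (append-↑ʳ F f (d₁ ∷ S) Fin.zero)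
      a-posS : ∀ i → a (posS i) ≡ S i
      a-posS i = trans (a-tail _) (append-↑ʳ F f (d₁ ∷ S) (Fin.suc i))

    numer₂-assemble : numer₂ b n a ≡ (b * valueP P + toℕ d₂) * D₂ + low₂ f d₁ S
    numer₂-assemble = begin
        bigEndian b n (λ t → toℕ (a t))
      ≡⟨ bigEndian-append b j₂ (suc (F + suc j₁)) (λ t → toℕ (a t)) ⟩
        bigEndian b j₂ (λ i → toℕ (a (posP i))) * b ^ suc (F + suc j₁) + bigEndian b (suc (F + suc j₁)) (λ j → toℕ (a (j₂ ↑ʳ j)))
      ≡⟨ cong₂ (λ u v → u * b ^ suc (F + suc j₁) + v)
           (bigEndian-cong b j₂ (λ i → cong toℕ (a-posP i))) (bigEndian-cong b (suc (F + suc j₁)) (λ j → cong toℕ (a-tail j))) ⟩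
        valueP P * b ^ suc (F + suc j₁) + (toℕ d₂ * b ^ (F + suc j₁) + bigEndian b (F + suc j₁) (λ j → toℕ (append F f (d₁ ∷ S) j)))
      ≡⟨ cong (λ z → valueP P * b ^ suc (F + suc j₁) + (toℕ d₂ * b ^ (F + suc j₁) + z))
           (trans (bigEndian-append b F (suc j₁) (λ j → toℕ (append F f (d₁ ∷ S) j)))
                  (cong₂ (λ u v → u * b ^ suc j₁ + v)
                     (bigEndian-cong b F (λ i → cong toℕ (append-↑ˡ F f (d₁ ∷ S) i)))
                     (bigEndian-cong b (suc j₁) (λ j → cong toℕ (append-↑ʳ F f (d₁ ∷ S) j))))) ⟩
        valueP P * (b * D) + (toℕ d₂ * D + (valueF f * b ^ suc j₁ + (toℕ d₁ * b ^ j₁ + valueS S)))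
      ≡⟨ solve 9 (λ p b D d₂ f s d₁ t S′ → p :* (b :* D) :+ (d₂ :* D :+ (f :* s :+ (d₁ :* t :+ S′)))
                                         := (b :* p :+ d₂) :* D :+ ((f :* s :+ S′) :+ t :* d₁))
           refl (valueP P) b D (toℕ d₂) (valueF f) (b ^ suc j₁) (toℕ d₁) (b ^ j₁) (valueS S) ⟩
        (b * valueP P + toℕ d₂) * D + low₂ f d₁ S
      ≡⟨ cong (λ e → (b * valueP P + toℕ d₂) * b ^ e + low₂ f d₁ S) n∸[1+j₂]≡F+[1+j₁] ⟨
        (b * valueP P + toℕ d₂) * D₂ + low₂ f d₁ S
      ∎
      where
      open ≡-Reasoning
      D = b ^ (F + suc j₁)

    numer₁-assemble : numer₁ b n σ Σ a ≡ (b * chosenValueS S + chosen pos₁ d₁) * D₁ + low₁ P d₂ f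
    numer₁-assemble = begin
        littleEndian b n c
      ≡⟨ littleEndian-append b j₂ (suc (F + suc j₁)) c ⟩
        littleEndian b j₂ (λ i → c (posP i)) + b ^ j₂ * littleEndian b (suc (F + suc j₁)) (λ j → c (j₂ ↑ʳ j))
      ≡⟨ cong₂ (λ u v → u + b ^ j₂ * v) (littleEndian-cong b j₂ (λ i → cong (chosen (posP i)) (a-posP i))) tail≡ ⟩
        chosenValueP P + b ^ j₂ * (chosen pos₂ d₂ + b * (chosenValueF f + b ^ F * (chosen pos₁ d₁ + b * chosenValueS S)))
      ≡⟨ solve 8 (λ p B y b q BF x s → p :+ B :* (y :+ b :* (q :+ BF :* (x :+ b :* s)))
                                     := (b :* s :+ x) :* (B :* (b :* BF)) :+ ((p :+ B :* (b :* q)) :+ B :* y))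
           refl (chosenValueP P) (b ^ j₂) (chosen pos₂ d₂) b (chosenValueF f) (b ^ F) (chosen pos₁ d₁) (chosenValueS S) ⟩
        (b * chosenValueS S + chosen pos₁ d₁) * (b ^ j₂ * (b * b ^ F)) + low₁ P d₂ f
      ≡⟨ cong (λ D → (b * chosenValueS S + chosen pos₁ d₁) * D + low₁ P d₂ f) D₁≡ ⟨
        (b * chosenValueS S + chosen pos₁ d₁) * D₁ + low₁ P d₂ f
      ∎
      where
      open ≡-Reasoning
      c : Fin n → ℕ
      c t = chosen t (a t)
      tail≡ : littleEndian b (suc (F + suc j₁)) (λ j → c (j₂ ↑ʳ j)) ≡
              chosen pos₂ d₂ + b * (chosenValueF f + b ^ F * (chosen pos₁ d₁ + b * chosenValueS S))
      tail≡ = begin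
          littleEndian b (suc (F + suc j₁)) (λ j → c (j₂ ↑ʳ j))
        ≡⟨ littleEndian-suc b (F + suc j₁) (λ j → c (j₂ ↑ʳ j)) ⟩
          c pos₂ + b * littleEndian b (F + suc j₁) (λ j → c (j₂ ↑ʳ Fin.suc j))
        ≡⟨ cong (λ z → c pos₂ + b * z) (littleEndian-append b F (suc j₁) (λ j → c (j₂ ↑ʳ Fin.suc j))) ⟩
          c pos₂ + b * (littleEndian b F (λ i → c (posF i)) + b ^ F * littleEndian b (suc j₁) (λ j → c (j₂ ↑ʳ Fin.suc (F ↑ʳ j))))
        ≡⟨ cong (λ z → c pos₂ + b * (littleEndian b F (λ i → c (posF i)) + b ^ F * z))
                (littleEndian-suc b j₁ (λ j → c (j₂ ↑ʳ Fin.suc (F ↑ʳ j)))) ⟩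
          c pos₂ + b * (littleEndian b F (λ i → c (posF i)) + b ^ F * (c pos₁ + b * littleEndian b j₁ (λ i → c (posS i))))
        ≡⟨ cong₂ (λ u v → c pos₂ + b * (u + b ^ F * (c pos₁ + b * v)))
                 (littleEndian-cong b F (λ i → cong (chosen (posF i)) (a-posF i)))
                 (littleEndian-cong b j₁ (λ i → cong (chosen (posS i)) (a-posS i))) ⟩
          c pos₂ + b * (chosenValueF f + b ^ F * (c pos₁ + b * chosenValueS S))
        ≡⟨ cong₂ (λ u v → u + b * (chosenValueF f + b ^ F * (v + b * chosenValueS S)))
                 (cong (chosen pos₂) (a-tail Fin.zero)) (cong (chosen pos₁) a-pos₁) ⟩
          chosen pos₂ d₂ + b * (chosenValueF f + b ^ F * (chosen pos₁ d₁ + b * chosenValueS S))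
        ∎

  low₁<D₁ : ∀ P d₂ f → low₁ P d₂ f < D₁
  low₁<D₁ P d₂ f = begin-strict
      low₁ P d₂ f
    ≡⟨ solve 5 (λ p B b q y → (p :+ B :* (b :* q)) :+ B :* y := p :+ B :* (y :+ b :* q)) refl (chosenValueP P) (b ^ j₂) b (chosenValueF f) (chosen pos₂ d₂) ⟩
      chosenValueP P + b ^ j₂ * (chosen pos₂ d₂ + b * chosenValueF f)
    <⟨ lowDigit< (littleEndian< b j₂ _ (λ i → Fin.toℕ<n (choose σ (Σ (posP i)) (P i))))
                 (lowDigit< (Fin.toℕ<n (choose σ (Σ pos₂) d₂)) (littleEndian< b F _ (λ i → Fin.toℕ<n (choose σ (Σ (posF i)) (f i))))) ⟩
      b ^ j₂ * (b * b ^ F)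
    ≡⟨ D₁≡ ⟨
      D₁
    ∎
    where open ≤-Reasoning

  low₂<D₂ : ∀ f d₁ S → low₂ f d₁ S < D₂
  low₂<D₂ f d₁ S = begin-strict
      low₂ f d₁ S
    ≡⟨ solve 5 (λ q b t s d → (q :* (b :* t) :+ s) :+ t :* d := q :* (b :* t) :+ (d :* t :+ s)) refl (valueF f) b (b ^ j₁) (valueS S) (toℕ d₁) ⟩
      valueF f * (b * b ^ j₁) + (toℕ d₁ * b ^ j₁ + valueS S)
    <⟨ highDigit< (bigEndian< b F _ (λ i → Fin.toℕ<n (f i))) (highDigit< (Fin.toℕ<n d₁) (bigEndian< b j₁ _ (λ i → Fin.toℕ<n (S i)))) ⟩
      b ^ F * (b * b ^ j₁)
    ≡⟨ D₂≡ ⟨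
      D₂
    ∎
    where open ≤-Reasoning

  cut₁ : ∀ P d₂ f d₁ S → Cut b D₁ (numer₁ b n σ Σ (assemble P d₂ f d₁ S))
  cut₁ P d₂ f d₁ S = record
    { high    = chosenValueS S
    ; digit   = chosen pos₁ d₁
    ; low     = low₁ P d₂ f
    ; digit<b = Fin.toℕ<n (choose σ (Σ pos₁) d₁)
    ; low<D   = low₁<D₁ P d₂ f
    ; N≡      = numer₁-assemble P d₂ f d₁ S
    }

  cut₂ : ∀ P d₂ f d₁ S → Cut b D₂ (numer₂ b n (assemble P d₂ f d₁ S))
  cut₂ P d₂ f d₁ S = record
    { high    = valueP P
    ; digit   = toℕ d₂
    ; low     = low₂ f d₁ S
    ; digit<b = Fin.toℕ<n d₂
    ; low<D   = low₂<D₂ f d₁ S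
    ; N≡      = numer₂-assemble P d₂ f d₁ S
    }

  scale-product : b ^ (n ∸ (j₁ + j₂)) * b ^ j₂ * b ^ j₁ * b ^ F ≡ D₁ * D₂
  scale-product = begin
      b ^ (n ∸ (j₁ + j₂)) * b ^ j₂ * b ^ j₁ * b ^ F
    ≡⟨ cong (λ e → b ^ e * b ^ j₂ * b ^ j₁ * b ^ F) n∸[j₁+j₂]≡2+F ⟩
      b * (b * b ^ F) * b ^ j₂ * b ^ j₁ * b ^ F
    ≡⟨ solve 4 (λ b x y z → b :* (b :* z) :* x :* y :* z := x :* (b :* z) :* (z :* (b :* y))) refl b (b ^ j₂) (b ^ j₁) (b ^ F) ⟩
      b ^ j₂ * (b * b ^ F) * (b ^ F * (b * b ^ j₁))
    ≡⟨ cong₂ _*_ D₁≡ D₂≡ ⟨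
      D₁ * D₂
    ∎
    where open ≡-Reasoning

module CellSums {c ℓ} (R : CommutativeRing c ℓ) (inv : CommutativeRing.Carrier R → CommutativeRing.Carrier R)
                (isInverse : FieldDefs.IsInverse R inv) (charZero : FieldDefs.CharZero R)
                (b : ℕ) (0<b : 0 < b) (ω : CommutativeRing.Carrier R) (ω-root : FieldDefs.PrimitiveRoot R b ω)
                (σ : Permutation b b) (j₁ j₂ F : ℕ) (Σ : Fin (j₂ ℕ.+ suc (F ℕ.+ suc j₁)) → Bool)
                {l₁ l₂ : ℕ} (0<l₁ : 0 < l₁) (l₁<b : l₁ < b) (0<l₂ : 0 < l₂) (l₂<b : l₂ < b) where
  open CommutativeRing R
  open FieldDefs R
  open IntegerSolver R
  open Summation R
  open DigitSums b
  open GeometricSums R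
  open FieldFacts R inv isInverse charZero
  open RootsOfUnity R inv isInverse charZero b ω ω-root
  open ChosenDigitSums R inv isInverse charZero b ω ω-root σ
  open PointTerms R inv isInverse charZero b 0<b ω
  open Decomposition b σ j₁ j₂ F Σ
  open import Relation.Binary.Reasoning.Setoid setoid

  ∑₃ : (Fin b → (Fin F → Fin b) → Fin b → Carrier) → Carrier
  ∑₃ h = ∑ b (λ d₂ → ∑digits b F (λ f → ∑ b (λ d₁ → h d₂ f d₁)))

  ∑₃-cong : ∀ {h k} → (∀ d₂ f d₁ → h d₂ f d₁ ≈ k d₂ f d₁) → ∑₃ h ≈ ∑₃ k
  ∑₃-cong h≈k = ∑-cong b (λ d₂ → ∑digits-cong F (λ f → ∑-cong b (λ d₁ → h≈k d₂ f d₁)))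

  ∑₃-+ : ∀ h k → ∑₃ (λ d₂ f d₁ → h d₂ f d₁ + k d₂ f d₁) ≈ ∑₃ h + ∑₃ k
  ∑₃-+ h k = trans (∑-cong b (λ d₂ → trans (∑digits-cong F (λ f → ∑-+ b _ _)) (∑digits-+ F _ _))) (∑-+ b _ _)

  ∑₃-indicator : ∀ {Q : Set} (d : Dec Q) h → ∑₃ (λ d₂ f d₁ → [ d ]· h d₂ f d₁) ≈ [ d ]· ∑₃ h
  ∑₃-indicator d h = trans (∑-cong b (λ d₂ → trans (∑digits-cong F (λ f → ∑-indicator d b _)) (∑digits-indicator d F _)))
                           (∑-indicator d b _)

  ∑₃-separable : ∀ u v w → ∑₃ (λ d₂ f d₁ → u d₂ * v f * w d₁) ≈ ∑ b u * (∑digits b F v * ∑ b w)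
  ∑₃-separable u v w = begin
      ∑ b (λ d₂ → ∑digits b F (λ f → ∑ b (λ d₁ → u d₂ * v f * w d₁)))
    ≈⟨ ∑-cong b (λ d₂ → ∑digits-cong F (λ f → sym (∑-*ˡ b (u d₂ * v f) w))) ⟩
      ∑ b (λ d₂ → ∑digits b F (λ f → u d₂ * v f * ∑ b w))
    ≈⟨ ∑-cong b (λ d₂ → trans (∑digits-cong F (λ f → *-assoc (u d₂) (v f) (∑ b w)))
                              (trans (sym (∑digits-*ˡ F (u d₂) _)) (*-congˡ (sym (∑digits-*ʳ F (∑ b w) v))))) ⟩
      ∑ b (λ d₂ → u d₂ * (∑digits b F v * ∑ b w))
    ≈⟨ ∑-*ʳ b _ u ⟨
      ∑ b u * (∑digits b F v * ∑ b w)
    ∎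

  ∑₃-vanishˡ : ∀ u v w → ∑ b u ≈ 0# → ∑₃ (λ d₂ f d₁ → u d₂ * v f * w d₁) ≈ 0#
  ∑₃-vanishˡ u v w ∑u≈0 = trans (∑₃-separable u v w) (trans (*-congʳ ∑u≈0) (zeroˡ _))

  ∑₃-vanishʳ : ∀ u v w → ∑ b w ≈ 0# → ∑₃ (λ d₂ f d₁ → u d₂ * v f * w d₁) ≈ 0#
  ∑₃-vanishʳ u v w ∑w≈0 = trans (∑₃-separable u v w) (trans (*-congˡ (trans (*-congˡ ∑w≈0) (zeroʳ _))) (zeroʳ _))

  ι₁ ι₂ : Carrier
  ι₁ = inv (fromℕ D₁)
  ι₂ = inv (fromℕ D₂)

  e₁ g₁ X e₂ g₂ Y : Fin b → Carrier
  e₁ d = ω ^ᴿ (chosen pos₁ d ℕ.* l₁)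
  g₁ d = geometric ω l₁ (chosen pos₁ d)
  X  d = fromℕ (b ℕ.^ j₁) * fromℕ (toℕ d)
  e₂ d = ω ^ᴿ (toℕ d ℕ.* l₂)
  g₂ d = geometric ω l₂ (toℕ d)
  Y  d = fromℕ (b ℕ.^ j₂) * fromℕ (chosen pos₂ d)

  cellProduct : (Fin j₂ → Fin b) → Fin b → (Fin F → Fin b) → Fin b → (Fin j₁ → Fin b) → Carrier
  cellProduct P d₂ f d₁ S = digitFactor l₁ (low₁ P d₂ f) D₁ (chosen pos₁ d₁) * digitFactor l₂ (low₂ f d₁ S) D₂ (toℕ d₂)

  ∑digits-one : Carrier
  ∑digits-one = ∑digits b F (λ _ → 1#)

  cellValue : Carrier
  cellValue = ∑ b (λ d → Y d * e₂ d * (ι₁ * ι₂)) * (∑digits-one * ∑ b (λ d → X d * e₁ d)) + ∑ b g₂ * (∑digits-one * ∑ b g₁)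

  ∑e₁≈0 : ∑ b e₁ ≈ 0#
  ∑e₁≈0 = trans (∑-choose (Σ pos₁) (λ k → ω ^ᴿ (toℕ k ℕ.* l₁))) (∑-roots≈0 0<l₁ l₁<b)

  ∑e₂*≈0 : ∀ x → ∑ b (λ d → e₂ d * x) ≈ 0#
  ∑e₂*≈0 x = trans (sym (∑-*ʳ b x e₂)) (trans (*-congʳ (∑-roots≈0 0<l₂ l₂<b)) (zeroˡ x))

  module _ (P : Fin j₂ → Fin b) (S : Fin j₁ → Fin b) where
    private
      ιι = ι₁ * ι₂

    A B AB : (Fin F → Fin b) → Carrier
    A f = fromℕ (chosenValueP P ℕ.+ b ℕ.^ j₂ ℕ.* (b ℕ.* chosenValueF f))
    B f = fromℕ (valueF f ℕ.* b ℕ.^ suc j₁ ℕ.+ valueS S)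
    AB f = A f * B f

    t₁ t₂ t₃ t₄ t₅ t₆ t₇ t₈ t₉ : Fin b → (Fin F → Fin b) → Fin b → Carrier
    t₁ d₂ f d₁ = e₂ d₂ * ιι * AB f * e₁ d₁
    t₂ d₂ f d₁ = e₂ d₂ * ιι * A f * (X d₁ * e₁ d₁)
    t₃ d₂ f d₁ = Y d₂ * e₂ d₂ * ιι * B f * e₁ d₁
    t₄ d₂ f d₁ = Y d₂ * e₂ d₂ * ιι * 1# * (X d₁ * e₁ d₁)
    t₅ d₂ f d₁ = g₂ d₂ * ι₁ * A f * e₁ d₁
    t₆ d₂ f d₁ = Y d₂ * g₂ d₂ * ι₁ * 1# * e₁ d₁
    t₇ d₂ f d₁ = e₂ d₂ * ι₂ * B f * g₁ d₁
    t₈ d₂ f d₁ = e₂ d₂ * ι₂ * 1# * (X d₁ * g₁ d₁)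
    t₉ d₂ f d₁ = g₂ d₂ * 1# * g₁ d₁

    expansion : Fin b → (Fin F → Fin b) → Fin b → Carrier
    expansion d₂ f d₁ =
      t₁ d₂ f d₁ + (t₂ d₂ f d₁ + (t₃ d₂ f d₁ + (t₄ d₂ f d₁ + (t₅ d₂ f d₁ + (t₆ d₂ f d₁ + (t₇ d₂ f d₁ + (t₈ d₂ f d₁ + t₉ d₂ f d₁)))))))

    cellProduct-expand : ∀ d₂ f d₁ → cellProduct P d₂ f d₁ S ≈ expansion d₂ f d₁
    cellProduct-expand d₂ f d₁ = trans (*-cong (+-congʳ (*-congʳ (-‿cong (*-congʳ low₁≈)))) (+-congʳ (*-congʳ (-‿cong (*-congʳ low₂≈)))))
      (solve 10 (λ a y β x i₁ i₂ E₁ G₁ E₂ G₂ →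
         (:- ((a :+ y) :* i₁) :* E₁ :- G₁) :* (:- ((β :+ x) :* i₂) :* E₂ :- G₂) :=
         E₂ :* (i₁ :* i₂) :* (a :* β) :* E₁ :+
         (E₂ :* (i₁ :* i₂) :* a :* (x :* E₁) :+
         (y :* E₂ :* (i₁ :* i₂) :* β :* E₁ :+
         (y :* E₂ :* (i₁ :* i₂) :* Κ1 :* (x :* E₁) :+
         (G₂ :* i₁ :* a :* E₁ :+
         (y :* G₂ :* i₁ :* Κ1 :* E₁ :+
         (E₂ :* i₂ :* β :* G₁ :+
         (E₂ :* i₂ :* Κ1 :* (x :* G₁) :+
         G₂ :* Κ1 :* G₁))))))))
        refl (A f) (Y d₂) (B f) (X d₁) ι₁ ι₂ (e₁ d₁) (g₁ d₁) (e₂ d₂) (g₂ d₂))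
      where
      Κ1 = con ℤ.1ℤ
      low₁≈ : fromℕ (low₁ P d₂ f) ≈ A f + Y d₂
      low₁≈ = trans (fromℕ-+ (chosenValueP P ℕ.+ b ℕ.^ j₂ ℕ.* (b ℕ.* chosenValueF f)) (b ℕ.^ j₂ ℕ.* chosen pos₂ d₂))
                    (+-congˡ (fromℕ-* (b ℕ.^ j₂) (chosen pos₂ d₂)))
      low₂≈ : fromℕ (low₂ f d₁ S) ≈ B f + X d₁
      low₂≈ = trans (fromℕ-+ (valueF f ℕ.* b ℕ.^ suc j₁ ℕ.+ valueS S) (b ℕ.^ j₁ ℕ.* toℕ d₁))
                    (+-congˡ (fromℕ-* (b ℕ.^ j₁) (toℕ d₁)))

    -- Every term is u(d₂)·v(f)·w(d₁); all but t₄ and t₉ contain a full sum ∑ e₁ or ∑ e₂, which vanishes.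
    ∑₃-cellProduct : ∑₃ (λ d₂ f d₁ → cellProduct P d₂ f d₁ S) ≈ cellValue
    ∑₃-cellProduct = begin
        ∑₃ (λ d₂ f d₁ → cellProduct P d₂ f d₁ S)
      ≈⟨ ∑₃-cong cellProduct-expand ⟩
        ∑₃ expansion
      ≈⟨ trans (∑₃-+ t₁ _) (+-congˡ (trans (∑₃-+ t₂ _) (+-congˡ (trans (∑₃-+ t₃ _) (+-congˡ (trans (∑₃-+ t₄ _)
           (+-congˡ (trans (∑₃-+ t₅ _) (+-congˡ (trans (∑₃-+ t₆ _) (+-congˡ (trans (∑₃-+ t₇ _) (+-congˡ (∑₃-+ t₈ t₉)))))))))))))) ⟩
        ∑₃ t₁ + (∑₃ t₂ + (∑₃ t₃ + (∑₃ t₄ + (∑₃ t₅ + (∑₃ t₆ + (∑₃ t₇ + (∑₃ t₈ + ∑₃ t₉)))))))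
      ≈⟨ +-cong (∑₃-vanishʳ (λ d → e₂ d * ιι) AB e₁ ∑e₁≈0)
        (+-cong (∑₃-vanishˡ (λ d → e₂ d * ιι) A (λ d → X d * e₁ d) (∑e₂*≈0 ιι))
        (+-cong (∑₃-vanishʳ (λ d → Y d * e₂ d * ιι) B e₁ ∑e₁≈0)
        (+-cong (∑₃-separable (λ d → Y d * e₂ d * ιι) (λ _ → 1#) (λ d → X d * e₁ d))
        (+-cong (∑₃-vanishʳ (λ d → g₂ d * ι₁) A e₁ ∑e₁≈0)
        (+-cong (∑₃-vanishʳ (λ d → Y d * g₂ d * ι₁) (λ _ → 1#) e₁ ∑e₁≈0)
        (+-cong (∑₃-vanishˡ (λ d → e₂ d * ι₂) B g₁ (∑e₂*≈0 ι₂))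
        (+-cong (∑₃-vanishˡ (λ d → e₂ d * ι₂) (λ _ → 1#) (λ d → X d * g₁ d) (∑e₂*≈0 ι₂))
                (∑₃-separable g₂ (λ _ → 1#) g₁)))))))) ⟩
        0# + (0# + (0# + (V₄ + (0# + (0# + (0# + (0# + V₉)))))))
      ≈⟨ solve 2 (λ u v → Κ0 :+ (Κ0 :+ (Κ0 :+ (u :+ (Κ0 :+ (Κ0 :+ (Κ0 :+ (Κ0 :+ v))))))) := u :+ v) refl V₄ V₉ ⟩
        cellValue
      ∎
      where
      Κ0 = con (ℤ.+ 0)
      V₄ = ∑ b (λ d → Y d * e₂ d * ιι) * (∑digits-one * ∑ b (λ d → X d * e₁ d))
      V₉ = ∑ b g₂ * (∑digits-one * ∑ b g₁)

  private
    ιι fB BF Bj₁ Bj₂ W q₁ q₂ sign Σ₁ Σ₂ : Carrier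
    ιι = ι₁ * ι₂
    fB = fromℕ b
    BF = fromℕ (b ℕ.^ F)
    Bj₁ = fromℕ (b ℕ.^ j₁)
    Bj₂ = fromℕ (b ℕ.^ j₂)
    W = fromℕ (b ℕ.^ (n ℕ.∸ (j₁ ℕ.+ j₂)))
    q₁ = inv (ω ^ᴿ l₁ - 1#)
    q₂ = inv (ω ^ᴿ l₂ - 1#)
    sign = signᴿ (signOf (Σ pos₂))
    Σ₁ = ∑ b (λ k → fromℕ (toℕ (σ ⟨$⟩ˡ k)) * expP inv ω (Σ pos₁) (toℕ k) l₁)
    Σ₂ = ∑ b (λ k → fromℕ (toℕ (σ ⟨$⟩ʳ k)) * ω ^ᴿ (toℕ k ℕ.* l₂))

  ∑digits-one≈ : ∑digits-one ≈ BF
  ∑digits-one≈ = trans (∑digits-const F 1#) (*-identityʳ BF)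

  ∑Xe₁≈ : ∑ b (λ d → X d * e₁ d) ≈ Bj₁ * Σ₁
  ∑Xe₁≈ = begin
      ∑ b (λ d → Bj₁ * fromℕ (toℕ d) * e₁ d)   ≈⟨ ∑-cong b (λ d → trans (*-assoc _ _ _) (*-congˡ (*-comm _ _))) ⟩
      ∑ b (λ d → Bj₁ * (e₁ d * fromℕ (toℕ d)))  ≈⟨ ∑-*ˡ b Bj₁ _ ⟨
      Bj₁ * ∑ b (λ d → e₁ d * fromℕ (toℕ d))    ≈⟨ *-congˡ (∑-ω^chosen*digit (Σ pos₁) l₁) ⟩
      Bj₁ * Σ₁                                  ∎

  ∑Ye₂≈ : ∑ b (λ d → Y d * e₂ d * ιι) ≈ Bj₂ * (sign * Σ₂) * ιι
  ∑Ye₂≈ = begin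
      ∑ b (λ d → Y d * e₂ d * ιι)                           ≈⟨ ∑-cong b (λ d → *-congʳ (*-assoc _ _ _)) ⟩
      ∑ b (λ d → Bj₂ * (fromℕ (chosen pos₂ d) * e₂ d) * ιι) ≈⟨ ∑-*ʳ b ιι _ ⟨
      ∑ b (λ d → Bj₂ * (fromℕ (chosen pos₂ d) * e₂ d)) * ιι ≈⟨ *-congʳ (∑-*ˡ b Bj₂ _) ⟨
      Bj₂ * ∑ b (λ d → fromℕ (chosen pos₂ d) * e₂ d) * ιι   ≈⟨ *-congʳ (*-congˡ (∑-chosen*ω^digit (Σ pos₂) 0<l₂ l₂<b)) ⟩
      Bj₂ * (sign * Σ₂) * ιι                                ∎

  ∑g₁≈ : ∑ b g₁ ≈ - (fB * q₁)
  ∑g₁≈ = trans (∑-choose (Σ pos₁) (λ k → geometric ω l₁ (toℕ k))) (∑-geometric 0<l₁ l₁<b)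

  W≈ : W ≈ fB * (fB * BF)
  W≈ = trans (reflexive (≡.cong (λ e → fromℕ (b ℕ.^ e)) n∸[j₁+j₂]≡2+F))
             (trans (fromℕ-* b (b ℕ.* b ℕ.^ F)) (*-congˡ (fromℕ-* b (b ℕ.^ F))))

  invW≈ : inv W ≈ Bj₂ * Bj₁ * BF * ιι
  invW≈ = sym (inverse-unique (b^e≉0 (n ℕ.∸ (j₁ ℕ.+ j₂))) (begin
      W * (Bj₂ * Bj₁ * BF * ιι)
    ≈⟨ solve 5 (λ w a c d i → w :* (a :* c :* d :* i) := w :* a :* c :* d :* i) refl W Bj₂ Bj₁ BF ιι ⟩
      W * Bj₂ * Bj₁ * BF * ιι
    ≈⟨ *-congʳ (trans (fromℕ-* (w ℕ.* b ℕ.^ j₂ ℕ.* b ℕ.^ j₁) (b ℕ.^ F)) (*-congʳ (trans (fromℕ-* (w ℕ.* b ℕ.^ j₂) (b ℕ.^ j₁)) (*-congʳ (fromℕ-* w (b ℕ.^ j₂)))))) ⟨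
      fromℕ (w ℕ.* b ℕ.^ j₂ ℕ.* b ℕ.^ j₁ ℕ.* b ℕ.^ F) * ιι
    ≈⟨ *-congʳ (trans (reflexive (≡.cong fromℕ scale-product)) (fromℕ-* D₁ D₂)) ⟩
      fromℕ D₁ * fromℕ D₂ * (ι₁ * ι₂)
    ≈⟨ solve 4 (λ a c i k → a :* c :* (i :* k) := a :* i :* (c :* k)) refl (fromℕ D₁) (fromℕ D₂) ι₁ ι₂ ⟩
      fromℕ D₁ * ι₁ * (fromℕ D₂ * ι₂)
    ≈⟨ *-cong (isInverse _ (b^e≉0 (n ℕ.∸ suc j₁))) (isInverse _ (b^e≉0 (n ℕ.∸ suc j₂))) ⟩
      1# * 1#
    ≈⟨ *-identityˡ 1# ⟩
      1#
    ∎))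
    where
    w = b ℕ.^ (n ℕ.∸ (j₁ ℕ.+ j₂))
    b^e≉0 : ∀ e → ¬ (fromℕ (b ℕ.^ e) ≈ 0#)
    b^e≉0 e = fromℕ-≉0 _ (ℕ.m^n>0 b {{ℕ.>-nonZero 0<b}} e)

  cellValue≈RHS : cellValue ≈ RHS inv ω b n σ (Σ pos₁) (signOf (Σ pos₂)) j₁ j₂ l₁ l₂
  cellValue≈RHS = begin
      ∑ b (λ d → Y d * e₂ d * ιι) * (∑digits-one * ∑ b (λ d → X d * e₁ d)) + ∑ b g₂ * (∑digits-one * ∑ b g₁)
    ≈⟨ +-cong (*-cong ∑Ye₂≈ (*-cong ∑digits-one≈ ∑Xe₁≈)) (*-cong (∑-geometric 0<l₂ l₂<b) (*-cong ∑digits-one≈ ∑g₁≈)) ⟩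
      Bj₂ * (sign * Σ₂) * ιι * (BF * (Bj₁ * Σ₁)) + (- (fB * q₂)) * (BF * (- (fB * q₁)))
    ≈⟨ solve 10 (λ a s S₂ i c d S₁ B Q₂ Q₁ →
          a :* (s :* S₂) :* i :* (c :* (d :* S₁)) :+ (:- (B :* Q₂)) :* (c :* (:- (B :* Q₁))) :=
          B :* (B :* c) :* (Q₁ :* Q₂) :+ s :* (a :* d :* c :* i) :* S₁ :* S₂)
        refl Bj₂ sign Σ₂ ιι BF Bj₁ Σ₁ fB q₂ q₁ ⟩
      fB * (fB * BF) * (q₁ * q₂) + sign * (Bj₂ * Bj₁ * BF * ιι) * Σ₁ * Σ₂
    ≈⟨ +-cong (*-cong W≈ (inv-* (ω^l-1≉0 0<l₁ l₁<b) (ω^l-1≉0 0<l₂ l₂<b))) (*-congʳ (*-congʳ (*-congˡ invW≈))) ⟨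
      W * inv ((ω ^ᴿ l₁ - 1#) * (ω ^ᴿ l₂ - 1#)) + sign * inv W * Σ₁ * Σ₂
    ∎

module Assembly {c ℓ} (R : CommutativeRing c ℓ) (inv : CommutativeRing.Carrier R → CommutativeRing.Carrier R)
                (isInverse : FieldDefs.IsInverse R inv) (charZero : FieldDefs.CharZero R)
                (b : ℕ) (0<b : 0 < b) (ω : CommutativeRing.Carrier R) (ω-root : FieldDefs.PrimitiveRoot R b ω)
                (σ : Permutation b b) (j₁ j₂ F : ℕ) (Σ : Fin (j₂ ℕ.+ suc (F ℕ.+ suc j₁)) → Bool)
                {m₁ m₂ : ℕ} (m₁<b^j₁ : m₁ < b ℕ.^ j₁) (m₂<b^j₂ : m₂ < b ℕ.^ j₂)
                {l₁ l₂ : ℕ} (0<l₁ : 0 < l₁) (l₁<b : l₁ < b) (0<l₂ : 0 < l₂) (l₂<b : l₂ < b) where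
  open CommutativeRing R
  open FieldDefs R
  open Summation R
  open DigitSums b
  open Counting R b 0<b
  open PointTerms R inv isInverse charZero b 0<b ω
  open Decomposition b σ j₁ j₂ F Σ
  open CellSums R inv isInverse charZero b 0<b ω ω-root σ j₁ j₂ F Σ 0<l₁ l₁<b 0<l₂ l₂<b
  open DigitExpansion using (append; littleEndian-cong)
  open import Relation.Binary.Reasoning.Setoid setoid

  summand : (Fin n → Fin b) → Carrier
  summand a = pointTerm n j₁ j₂ m₁ m₂ l₁ l₂ (numer₁ b n σ Σ a) (numer₂ b n a)

  ∑digits-assemble : ∀ (g : (Fin n → Fin b) → Carrier) →
    ∑digits b n g ≈ ∑digits b j₂ (λ P → ∑₃ (λ d₂ f d₁ → ∑digits b j₁ (λ S → g (assemble P d₂ f d₁ S))))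
  ∑digits-assemble g = trans (∑digits-append j₂ (suc (F ℕ.+ suc j₁)) g)
    (∑digits-cong j₂ (λ P → ∑-cong b (λ d₂ → ∑digits-append F (suc j₁) (λ y → g (append j₂ P (d₂ ∷ y))))))

  summand-assemble : ∀ P d₂ f d₁ S →
    summand (assemble P d₂ f d₁ S) ≈ [ valueP P ≟ m₂ ]· ([ chosenValueS S ≟ m₁ ]· cellProduct P d₂ f d₁ S)
  summand-assemble P d₂ f d₁ S = pointTerm-at-cuts j₁<n j₂<n (cut₁ P d₂ f d₁ S) (cut₂ P d₂ f d₁ S) l₁ l₂ m₁ m₂

  count-chosenValueS : ∀ x → ∑digits b j₁ (λ S → [ chosenValueS S ≟ m₁ ]· x) ≈ x
  count-chosenValueS x = trans
    (∑digits-cong j₁ (λ S → reflexive (≡.cong (λ v → [ v ≟ m₁ ]· x)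
      (littleEndian-cong b j₁ (λ t → ≡.cong toℕ (≡.sym (choosePermutation-⟨$⟩ʳ σ (Σ (posS t)) (S t))))))))
    (count-littleEndian j₁ (λ t → choosePermutation σ (Σ (posS t))) m₁<b^j₁ x)

  ∑-given-P : ∀ P → ∑₃ (λ d₂ f d₁ → ∑digits b j₁ (λ S → [ valueP P ≟ m₂ ]· ([ chosenValueS S ≟ m₁ ]· cellProduct P d₂ f d₁ S)))
                 ≈ [ valueP P ≟ m₂ ]· cellValue
  ∑-given-P P = begin
      ∑₃ (λ d₂ f d₁ → ∑digits b j₁ (λ S → [ valueP P ≟ m₂ ]· ([ chosenValueS S ≟ m₁ ]· cellProduct P d₂ f d₁ S)))
    ≈⟨ ∑₃-cong (λ d₂ f d₁ → ∑digits-indicator (valueP P ≟ m₂) j₁ _) ⟩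
      ∑₃ (λ d₂ f d₁ → [ valueP P ≟ m₂ ]· ∑digits b j₁ (λ S → [ chosenValueS S ≟ m₁ ]· cellProduct P d₂ f d₁ S))
    ≈⟨ ∑₃-indicator (valueP P ≟ m₂) _ ⟩
      [ valueP P ≟ m₂ ]· ∑₃ (λ d₂ f d₁ → ∑digits b j₁ (λ S → [ chosenValueS S ≟ m₁ ]· cellProduct P d₂ f d₁ S))
    ≈⟨ indicator-congʳ (valueP P ≟ m₂) (begin
        ∑₃ (λ d₂ f d₁ → ∑digits b j₁ (λ S → [ chosenValueS S ≟ m₁ ]· cellProduct P d₂ f d₁ S))
      ≈⟨ ∑-cong b (λ d₂ → ∑digits-cong F (λ f → ∑-∑digits b j₁ _)) ⟩
        ∑ b (λ d₂ → ∑digits b F (λ f → ∑digits b j₁ (λ S → ∑ b (λ d₁ → [ chosenValueS S ≟ m₁ ]· cellProduct P d₂ f d₁ S))))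
      ≈⟨ ∑-cong b (λ d₂ → ∑digits-swap F j₁ _) ⟩
        ∑ b (λ d₂ → ∑digits b j₁ (λ S → ∑digits b F (λ f → ∑ b (λ d₁ → [ chosenValueS S ≟ m₁ ]· cellProduct P d₂ f d₁ S))))
      ≈⟨ ∑-∑digits b j₁ _ ⟩
        ∑digits b j₁ (λ S → ∑₃ (λ d₂ f d₁ → [ chosenValueS S ≟ m₁ ]· cellProduct P d₂ f d₁ S))
      ≈⟨ ∑digits-cong j₁ (λ S → trans (∑₃-indicator (chosenValueS S ≟ m₁) _) (indicator-congʳ (chosenValueS S ≟ m₁) (∑₃-cellProduct P S))) ⟩
        ∑digits b j₁ (λ S → [ chosenValueS S ≟ m₁ ]· cellValue)
      ≈⟨ count-chosenValueS cellValue ⟩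
        cellValue
      ∎) ⟩
      [ valueP P ≟ m₂ ]· cellValue
    ∎

  LHS≈RHS : LHS inv ω b n σ Σ j₁ j₂ m₁ m₂ l₁ l₂ ≈ RHS inv ω b n σ (Σ pos₁) (signOf (Σ pos₂)) j₁ j₂ l₁ l₂
  LHS≈RHS = begin
      ∑digits b n summand
    ≈⟨ ∑digits-assemble summand ⟩
      ∑digits b j₂ (λ P → ∑₃ (λ d₂ f d₁ → ∑digits b j₁ (λ S → summand (assemble P d₂ f d₁ S))))
    ≈⟨ ∑digits-cong j₂ (λ P → trans (∑₃-cong (λ d₂ f d₁ → ∑digits-cong j₁ (summand-assemble P d₂ f d₁))) (∑-given-P P)) ⟩
      ∑digits b j₂ (λ P → [ valueP P ≟ m₂ ]· cellValue)
    ≈⟨ count-bigEndian j₂ m₂<b^j₂ cellValue ⟩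
      cellValue
    ≈⟨ cellValue≈RHS ⟩
      RHS inv ω b n σ (Σ pos₁) (signOf (Σ pos₂)) j₁ j₂ l₁ l₂
    ∎

open import Data.Nat.Base using (_+_; _^_; _∸_)

-- p and s are read off Σ at the 0-based positions n − 1 − j₁ and j₂; the value outside 0 … n − 1 never matters.
bitAt : (n : ℕ) → (Fin n → Bool) → ℕ → Bool
bitAt zero    Σ k       = true
bitAt (suc n) Σ zero    = Σ Fin.zero
bitAt (suc n) Σ (suc k) = bitAt n (λ i → Σ (Fin.suc i)) k

bitAt-toℕ : ∀ n (Σ : Fin n → Bool) i → bitAt n Σ (toℕ i) ≡ Σ i
bitAt-toℕ (suc n) Σ Fin.zero    = ≡.refl
bitAt-toℕ (suc n) Σ (Fin.suc i) = bitAt-toℕ n (λ i → Σ (Fin.suc i)) i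

module _ {c ℓ} (R : CommutativeRing c ℓ) (inv : CommutativeRing.Carrier R → CommutativeRing.Carrier R)
         (isInverse : FieldDefs.IsInverse R inv) (charZero : FieldDefs.CharZero R)
         (b : ℕ) (0<b : 0 < b) (ω : CommutativeRing.Carrier R) (ω-root : FieldDefs.PrimitiveRoot R b ω)
         (σ : Permutation b b) {j₁ j₂ F m₁ m₂ l₁ l₂ : ℕ} (m₁<b^j₁ : m₁ < b ^ j₁) (m₂<b^j₂ : m₂ < b ^ j₂)
         (0<l₁ : 0 < l₁) (l₁<b : l₁ < b) (0<l₂ : 0 < l₂) (l₂<b : l₂ < b) where
  open CommutativeRing R using (_≈_; trans; reflexive)

  LHS≈RHS-bitAt : ∀ n (Σ : Fin n → Bool) → n ≡ j₂ + suc (F + suc j₁) →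
    FieldDefs.LHS R inv ω b n σ Σ j₁ j₂ m₁ m₂ l₁ l₂ ≈
    FieldDefs.RHS R inv ω b n σ (bitAt n Σ (n ∸ suc j₁)) (signOf (bitAt n Σ j₂)) j₁ j₂ l₁ l₂
  LHS≈RHS-bitAt .(j₂ + suc (F + suc j₁)) Σ ≡.refl =
    trans (Assembly.LHS≈RHS R inv isInverse charZero b 0<b ω ω-root σ j₁ j₂ F Σ m₁<b^j₁ m₂<b^j₂ 0<l₁ l₁<b 0<l₂ l₂<b)
          (reflexive (≡.cong₂ (λ p s → FieldDefs.RHS R inv ω b n σ p s j₁ j₂ l₁ l₂) bit₁ (≡.cong signOf bit₂)))
    where
    open Decomposition b σ j₁ j₂ F Σ
    bit₁ : Σ pos₁ ≡ bitAt n Σ (n ∸ suc j₁)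
    bit₁ = ≡.trans (≡.sym (bitAt-toℕ n Σ pos₁)) (≡.cong (bitAt n Σ) (≡.trans toℕ-pos₁ (≡.sym n∸[1+j₁]≡j₂+[1+F])))
      where
      toℕ-pos₁ : toℕ pos₁ ≡ j₂ + suc F
      toℕ-pos₁ = ≡.trans (Fin.toℕ-↑ʳ j₂ _) (≡.cong (λ k → j₂ + suc k) (≡.trans (Fin.toℕ-↑ʳ F (Fin.zero {j₁})) (ℕ.+-identityʳ F)))
    bit₂ : Σ pos₂ ≡ bitAt n Σ j₂
    bit₂ = ≡.trans (≡.sym (bitAt-toℕ n Σ pos₂)) (≡.cong (bitAt n Σ) (≡.trans (Fin.toℕ-↑ʳ j₂ (Fin.zero {F + suc j₁})) (ℕ.+-identityʳ j₂)))

lemma9 : ∀ {c ℓ} (b : ℕ) → 2 ≤ b → (n : ℕ) (σ : Permutation b b) (Σ : Fin n → Bool) →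
    Σ[ P ∈ (ℕ → Bool) ] Σ[ S ∈ (ℕ → Sign) ]
      ((R : CommutativeRing c ℓ) →
        (inv : CommutativeRing.Carrier R → CommutativeRing.Carrier R) → FieldDefs.IsInverse R inv → FieldDefs.CharZero R →
        (ω : CommutativeRing.Carrier R) → FieldDefs.PrimitiveRoot R b ω →
        (j₁ j₂ : ℕ) → j₁ + j₂ + 1 < n →
        (m₁ m₂ : ℕ) → m₁ < b ^ j₁ → m₂ < b ^ j₂ →
        (ℓ₁ ℓ₂ : ℕ) → 1 ≤ ℓ₁ → ℓ₁ < b → 1 ≤ ℓ₂ → ℓ₂ < b →
        CommutativeRing._≈_ R (FieldDefs.LHS R inv ω b n σ Σ j₁ j₂ m₁ m₂ ℓ₁ ℓ₂)
          (FieldDefs.RHS R inv ω b n σ (P j₁) (S j₂) j₁ j₂ ℓ₁ ℓ₂))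
lemma9 b 2≤b n σ Σ =
  (λ j → bitAt n Σ (n ∸ suc j)) , (λ j → signOf (bitAt n Σ j)) ,
  λ R inv isInverse charZero ω ω-root j₁ j₂ j₁+j₂+1<n m₁ m₂ m₁<b^j₁ m₂<b^j₂ ℓ₁ ℓ₂ 0<ℓ₁ ℓ₁<b 0<ℓ₂ ℓ₂<b →
    LHS≈RHS-bitAt R inv isInverse charZero b (ℕ.<-≤-trans (s≤s z≤n) 2≤b) ω ω-root σ
      m₁<b^j₁ m₂<b^j₂ 0<ℓ₁ ℓ₁<b 0<ℓ₂ ℓ₂<b n Σ (n-split j₁ j₂ j₁+j₂+1<n)
  where
  n-split : ∀ j₁ j₂ → j₁ + j₂ + 1 < n → n ≡ j₂ + suc (n ∸ suc (j₁ + j₂ + 1) + suc j₁)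
  n-split j₁ j₂ j₁+j₂+1<n = ≡.trans (≡.sym (ℕ.m∸n+n≡m j₁+j₂+1<n))
    (solve 3 (λ f x y → f :+ (con 1 :+ (x :+ y :+ con 1)) := y :+ (con 1 :+ (f :+ (con 1 :+ x)))) ≡.refl (n ∸ suc (j₁ + j₂ + 1)) j₁ j₂)
    where open +-*-Solver
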